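{- Let $n,r$ be positive integers with $d=\gcd(r,n)$, $r$ even, and $\frac nd$ even and not divisible by $3$; let $K_r=2^{2r}-2^r+1$. Then $$K_r^{ -1}\equiv\sum_{i=0}^{d-1}\sum_{j=0}^{\frac nd-1}a_{i,j}2^{i-jr}\pmod{2^n-1},$$ where $(a_{i,j})$ is the $d\times\frac nd$ matrix whose row $0$ is $a_1$ and whose rows $1,2,\dots,d-1$ are alternately $x,y,x,y,\dots,y,x$ (row $i$ equals $x$ for odd $i$ and $y$ for even $i\ge2$), with, for $x_1=(1,1,0,0,0,1)$ and $x_2=(1,0,0,0,1,1)$: \begin{enumerate} \item[(a)] if $\frac nd=6k+2$: $a_1=(1,1,x_1^{k})$, $x=(1,0,1,0,\dots,1,0)$, $y=(0,1,0,1,\dots,0,1)$; \item[(b)] if $\frac nd=6k+4$: $a_1=(1,0,1,1,x_2^{k})$, $x=(0,1,0,1,\dots,0,1)$, $y=(1,0,1,0,\dots,1,0)$, \end{enumerate} where $x,y$ are alternating sequences of length $\frac nd$. In both cases $\mathrm{wt}(K_r^{ -1})=\frac{n+2}{2}$.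
   Context: $K_r^{ -1}$ denotes the least positive residue of the inverse of $K_r$ modulo $2^n-1$ (which exists under these hypotheses when it is claimed), and $\mathrm{wt}(m)$ is the number of ones in the binary expansion of $m$. Powers $2^{m}$ with arbitrary integer $m$ are understood modulo $2^n-1$. Tuples containing sequences denote concatenation; $u^{k}$ denotes $k$-fold concatenation of $u$ (empty if $k=0$); $k$ is a nonnegative integer. -}

module Defs where

open import Data.Nat using (ℕ; zero; suc; _+_; _*_; _∸_; _^_; _/_; _%_; _<_)
open import Data.Product using (_×_)
open import Relation.Binary.PropositionalEquality using (_≡_)
open import Data.Integer as ℤ using (ℤ; +_; _%ℕ_)
open import Data.List using (List; []; _∷_; _++_; concat; replicate)

-- Binary weight (number of ones in the binary expansion), fuel-based;
-- fuel m suffices since m halves at each step.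
wtAux : ℕ → ℕ → ℕ
wtAux zero    m = 0
wtAux (suc f) m = m % 2 + wtAux f (m / 2)

wt : ℕ → ℕ
wt m = wtAux m m

-- 2^e for an arbitrary integer exponent e, understood modulo 2^n - 1
-- (i.e. 2^(e mod n)); the n = 0 case is never used.
pow2 : (n : ℕ) → ℤ → ℕ
pow2 zero    e = 1
pow2 (suc n) e = 2 ^ (e %ℕ suc n)

K : ℕ → ℕ
K r = 2 ^ (2 * r) ∸ 2 ^ r + 1

-- x mod M (least nonnegative residue); M = 0 case unused (M = 2^n - 1 ≥ 3)
_mod_ : ℕ → ℕ → ℕ
x mod zero  = x
x mod suc M = x % suc M

IsLeastPosInverse : ℕ → ℕ → ℕ → Set
IsLeastPosInverse M a v = (0 < v) × (v < M) × ((a * v) mod M ≡ 1)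

_^^_ : List ℕ → ℕ → List ℕ
u ^^ k = concat (replicate k u)

x₁ x₂ : List ℕ
x₁ = 1 ∷ 1 ∷ 0 ∷ 0 ∷ 0 ∷ 1 ∷ []
x₂ = 1 ∷ 0 ∷ 0 ∷ 0 ∷ 1 ∷ 1 ∷ []

alt : ℕ → ℕ → List ℕ
alt b zero    = []
alt b (suc m) = b ∷ alt (1 ∸ b) m

nth : List ℕ → ℕ → ℕ
nth []       j       = 0
nth (a ∷ as) zero    = a
nth (a ∷ as) (suc j) = nth as j

-- matrix with row 0 = a1 and rows i ≥ 1 equal to x (i odd), y (i even)
rowOf : List ℕ → List ℕ → List ℕ → ℕ → List ℕ
rowOf a1 x y zero          = a1
rowOf a1 x y (suc zero)    = x
rowOf a1 x y (suc (suc i)) = rowOf y x y i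

matA : ℕ → ℕ → ℕ → ℕ → ℕ
matA k m i j = nth (rowOf (1 ∷ 1 ∷ (x₁ ^^ k)) (alt 1 m) (alt 0 m) i) j

matB : ℕ → ℕ → ℕ → ℕ → ℕ
matB k m i j = nth (rowOf (1 ∷ 0 ∷ 1 ∷ 1 ∷ (x₂ ^^ k)) (alt 0 m) (alt 1 m) i) j

Σ< : ℕ → (ℕ → ℕ) → ℕ
Σ< zero    f = 0
Σ< (suc c) f = Σ< c f + f c

S : (n r d m : ℕ) → (ℕ → ℕ → ℕ) → ℕ
S n r d m a = Σ< d (λ i → Σ< m (λ j → a i j * pow2 n (+ i ℤ.- + (j * r))))

module Submission where

-- Work modulo M = 2^n - 1 with s = 2^r and t = 2^(d w), where w ≡ -r/d (mod n/d), so that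
-- s t ≡ 1.  Then K_r = Φ₆(s) for Φ₆(X) = X² - X + 1, and K_r S ≡ 1 follows from
-- Φ₆(t) S ≡ t².  Reading row i of the matrix as the polynomial R_i(t) = Σ_j a_{i,j} t^j
-- gives S ≡ Σ_i 2^i R_i(t).  Since t^(n/d) ≡ 1, the alternating rows satisfy t x ≡ y and
-- t y ≡ x, hence Φ₆(t) x ≡ 2x - y, and 2^d x ≡ y because 2^d is an odd power of t; over the
-- rows 1, ..., d - 1 the sum telescopes to Φ₆(t) S ≡ Φ₆(t) a₁ - y, and a polynomial identity
-- in t gives Φ₆(t) a₁ ≡ t² + y.
-- For the weight, the exponents i - j r, reduced mod n, are pairwise distinct (j ↦ -j r/d
-- permutes the residues mod n/d), so S < 2^n has the matrix entries as its binary digits and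
-- weight (n + 2)/2; being neither 0 nor n, S is already the least positive residue.

open import Defs
open import Data.Nat using (ℕ; zero; suc; NonZero; _≤_; _<_; z≤n; s≤s)
open import Data.Product using (_×_; _,_; proj₁; proj₂; ∃)
open import Function using (_∘_)
open import Relation.Binary.PropositionalEquality
open import Relation.Nullary using (contradiction)

module _ where
  open import Data.Nat using (_+_; _*_; _∸_; _^_; _/_; _%_)
  open import Data.Nat.Properties
  open import Data.Nat.DivMod hiding (_mod_)
  open import Data.Nat.Tactic.RingSolver using (solve-∀)
  open import Data.Fin using (Fin; toℕ; fromℕ<)
  import Data.Fin.Properties as Fin
  open import Data.Fin.Permutation using (Permutation; permutation; _⟨$⟩ʳ_)
  open import Algebra.Properties.CommutativeMonoid.Sum +-0-commutativeMonoid using (sum-permute; sum-cong-≗)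
    renaming (sum to ∑)
  open import Algebra.Properties.CommutativeSemigroup +-commutativeSemigroup using (interchange)
  open import Algebra.Properties.CommutativeSemigroup *-commutativeSemigroup using (x∙yz≈y∙xz)

  Σ<-cong : ∀ c {f g : ℕ → ℕ} → (∀ i → i < c → f i ≡ g i) → Σ< c f ≡ Σ< c g
  Σ<-cong zero    f≡g = refl
  Σ<-cong (suc c) f≡g = cong₂ _+_ (Σ<-cong c (λ i i<c → f≡g i (m<n⇒m<1+n i<c))) (f≡g c (n<1+n c))

  Σ<-cong-≗ : ∀ c {f g : ℕ → ℕ} → f ≗ g → Σ< c f ≡ Σ< c g
  Σ<-cong-≗ c f≗g = Σ<-cong c (λ i _ → f≗g i)

  Σ<-suc : ∀ c f → Σ< (suc c) f ≡ f 0 + Σ< c (f ∘ suc)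
  Σ<-suc zero    f = +-comm 0 (f 0)
  Σ<-suc (suc c) f = trans (cong (_+ f (suc c)) (Σ<-suc c f)) (+-assoc (f 0) _ _)

  Σ<-*ˡ : ∀ c a f → Σ< c (λ i → a * f i) ≡ a * Σ< c f
  Σ<-*ˡ zero    a f = sym (*-zeroʳ a)
  Σ<-*ˡ (suc c) a f = trans (cong (_+ a * f c) (Σ<-*ˡ c a f)) (sym (*-distribˡ-+ a _ _))

  Σ<-const : ∀ c p → Σ< c (λ _ → p) ≡ c * p
  Σ<-const zero    p = refl
  Σ<-const (suc c) p = trans (cong (_+ p) (Σ<-const c p)) (+-comm (c * p) p)

  Σ<-+ : ∀ c f g → Σ< c (λ i → f i + g i) ≡ Σ< c f + Σ< c g
  Σ<-+ zero    f g = refl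
  Σ<-+ (suc c) f g = trans (cong (_+ (f c + g c)) (Σ<-+ c f g)) (+-+-swap (Σ< c f) (Σ< c g) (f c) (g c))
    where
    +-+-swap : ∀ a b x y → (a + b) + (x + y) ≡ (a + x) + (b + y)
    +-+-swap = solve-∀

  Σ<-comm : ∀ a b (F : ℕ → ℕ → ℕ) → Σ< a (λ i → Σ< b (F i)) ≡ Σ< b (λ j → Σ< a (λ i → F i j))
  Σ<-comm zero    b F = sym (trans (Σ<-const b 0) (*-zeroʳ b))
  Σ<-comm (suc a) b F = trans (cong (_+ Σ< b (F a)) (Σ<-comm a b F)) (sym (Σ<-+ b _ _))

  Σ<-split : ∀ a b f → Σ< (a + b) f ≡ Σ< a f + Σ< b (λ i → f (a + i))
  Σ<-split a zero    f = trans (cong (λ z → Σ< z f) (+-identityʳ a)) (sym (+-identityʳ _))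
  Σ<-split a (suc b) f = trans (cong (λ z → Σ< z f) (+-suc a b))
    (trans (cong (_+ f (a + b)) (Σ<-split a b f)) (+-assoc (Σ< a f) _ _))

  Σ<-* : ∀ m d G → Σ< (m * d) G ≡ Σ< m (λ l → Σ< d (λ i → G (l * d + i)))
  Σ<-* zero    d G = refl
  Σ<-* (suc m) d G = trans (cong (λ z → Σ< z G) (+-comm d (m * d)))
    (trans (Σ<-split (m * d) d G) (cong (_+ Σ< d (λ i → G (m * d + i))) (Σ<-* m d G)))

  Σ<-divMod : ∀ m d .{{_ : NonZero d}} (F : ℕ → ℕ → ℕ) →
              Σ< (m * d) (λ e → F (e % d) (e / d)) ≡ Σ< d (λ i → Σ< m (F i))
  Σ<-divMod m d F = trans (Σ<-* m d _)
    (trans (Σ<-cong-≗ m (λ l → Σ<-cong d (λ i i<d → cong₂ F ([m*n+o]%n≡o l i<d) ([m*n+o]/n≡m l i<d))))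
           (Σ<-comm m d (λ l i → F i l)))
    where
    [m*n+o]%n≡o : ∀ l {i} → i < d → (l * d + i) % d ≡ i
    [m*n+o]%n≡o l {i} i<d = trans (cong (_% d) (+-comm (l * d) i)) (trans ([m+kn]%n≡m%n i l d) (m<n⇒m%n≡m i<d))
    [m*n+o]/n≡m : ∀ l {i} → i < d → (l * d + i) / d ≡ l
    [m*n+o]/n≡m l {i} i<d = trans (+-distrib-/ (l * d) i (subst (_< d) (sym (cong₂ _+_ (m*n%n≡0 l d) (m<n⇒m%n≡m i<d))) i<d))
                                 (trans (cong₂ _+_ (m*n/n≡m l d) (m<n⇒m/n≡0 i<d)) (+-identityʳ l))

  Σ<≡∑ : ∀ c f → Σ< c f ≡ ∑ {c} (f ∘ toℕ)
  Σ<≡∑ zero    f = refl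
  Σ<≡∑ (suc c) f = trans (Σ<-suc c f) (cong (f 0 +_) (Σ<≡∑ c (f ∘ suc)))

  Σ<-permute : ∀ m (g h : ℕ → ℕ) → (∀ j → j < m → g j < m) → (∀ j → j < m → h j < m)
               → (∀ j → j < m → g (h j) ≡ j) → (∀ j → j < m → h (g j) ≡ j)
               → ∀ f → Σ< m (f ∘ g) ≡ Σ< m f
  Σ<-permute m g h g< h< gh hg f = begin
      Σ< m (f ∘ g)                     ≡⟨ Σ<≡∑ m _ ⟩
      ∑ {m} (f ∘ g ∘ toℕ)              ≡⟨ sum-cong-≗ (λ j → cong f (sym (Fin.toℕ-fromℕ< (g< (toℕ j) (Fin.toℕ<n j))))) ⟩
      ∑ {m} (f ∘ toℕ ∘ (π ⟨$⟩ʳ_))      ≡⟨ sym (sum-permute (f ∘ toℕ) π) ⟩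
      ∑ {m} (f ∘ toℕ)                  ≡⟨ sym (Σ<≡∑ m f) ⟩
      Σ< m f                           ∎
    where
    open ≡-Reasoning
    onFin : (k : ℕ → ℕ) → (∀ j → j < m → k j < m) → Fin m → Fin m
    onFin k k< j = fromℕ< (k< (toℕ j) (Fin.toℕ<n j))
    inverse : ∀ k l k< l< → (∀ j → j < m → k (l j) ≡ j) → ∀ j → onFin k k< (onFin l l< j) ≡ j
    inverse k l k< l< kl j = Fin.toℕ-injective
      (trans (Fin.toℕ-fromℕ< _) (trans (cong k (Fin.toℕ-fromℕ< _)) (kl (toℕ j) (Fin.toℕ<n j))))
    π : Permutation m m
    π = permutation (onFin g g<) (onFin h h<) (inverse g h g< h< gh) (inverse h g h< g< hg)

  wtAux-0 : ∀ f → wtAux f 0 ≡ 0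
  wtAux-0 zero    = refl
  wtAux-0 (suc f) = wtAux-0 f

  /2≤pred : ∀ x f → x ≤ suc f → x / 2 ≤ f
  /2≤pred zero    f _         = z≤n
  /2≤pred (suc x) f (s≤s x≤f) = ≤-trans (≤-pred (m/n<m (suc x) 2 (s≤s (s≤s z≤n)))) x≤f

  wtAux-fuel : ∀ f g x → x ≤ f → x ≤ g → wtAux f x ≡ wtAux g x
  wtAux-fuel zero    g       zero _   _   = sym (wtAux-0 g)
  wtAux-fuel (suc f) zero    zero _   _   = wtAux-0 (suc f)
  wtAux-fuel (suc f) (suc g) x    x≤f x≤g =
    cong (x % 2 +_) (wtAux-fuel f g (x / 2) (/2≤pred x f x≤f) (/2≤pred x g x≤g))

  wt-unfold : ∀ x → wt x ≡ x % 2 + wt (x / 2)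
  wt-unfold zero    = refl
  wt-unfold (suc x) = cong (suc x % 2 +_) (wtAux-fuel x (suc x / 2) (suc x / 2) (/2≤pred (suc x) x ≤-refl) ≤-refl)

  wt-bit+*2 : ∀ b y → b ≤ 1 → wt (b + y * 2) ≡ b + wt y
  wt-bit+*2 b y b≤1 = trans (wt-unfold (b + y * 2)) (cong₂ _+_ %2≡b (cong wt /2≡y))
    where
    b<2 : b < 2
    b<2 = s≤s b≤1
    %2≡b : (b + y * 2) % 2 ≡ b
    %2≡b = trans ([m+kn]%n≡m%n b y 2) (m<n⇒m%n≡m b<2)
    /2≡y : (b + y * 2) / 2 ≡ y
    /2≡y = trans (+-distrib-/ b (y * 2) (subst (_< 2) (sym (trans (cong₂ _+_ (m<n⇒m%n≡m b<2) (m*n%n≡0 y 2)) (+-identityʳ b))) b<2))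
                 (cong₂ _+_ (m<n⇒m/n≡0 b<2) (m*n/n≡m y 2))

  binary : ℕ → (ℕ → ℕ) → ℕ
  binary N b = Σ< N (λ e → b e * 2 ^ e)

  binary-suc : ∀ N b → binary (suc N) b ≡ b 0 + binary N (b ∘ suc) * 2
  binary-suc N b = trans (Σ<-suc N _) (cong₂ _+_ (*-identityʳ (b 0))
    (trans (Σ<-cong-≗ N (λ e → x∙yz≈y∙xz (b (suc e)) 2 (2 ^ e))) (trans (Σ<-*ˡ N 2 _) (*-comm 2 (binary N (b ∘ suc))))))

  Bits : (ℕ → ℕ) → Set
  Bits b = ∀ e → b e ≤ 1

  wt-binary : ∀ N b → Bits b → wt (binary N b) ≡ Σ< N b
  wt-binary zero    b bits = refl
  wt-binary (suc N) b bits = begin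
    wt (binary (suc N) b)                ≡⟨ cong wt (binary-suc N b) ⟩
    wt (b 0 + binary N (b ∘ suc) * 2)    ≡⟨ wt-bit+*2 (b 0) (binary N (b ∘ suc)) (bits 0) ⟩
    b 0 + wt (binary N (b ∘ suc))        ≡⟨ cong (b 0 +_) (wt-binary N (b ∘ suc) (bits ∘ suc)) ⟩
    b 0 + Σ< N (b ∘ suc)                 ≡⟨ sym (Σ<-suc N b) ⟩
    Σ< (suc N) b                         ∎
    where open ≡-Reasoning

  binary<2^ : ∀ N b → Bits b → binary N b < 2 ^ N
  binary<2^ zero    b bits = s≤s z≤n
  binary<2^ (suc N) b bits = subst (_< 2 ^ suc N) (sym (binary-suc N b))
    (≤-trans (s≤s (+-monoˡ-≤ (binary N (b ∘ suc) * 2) (bits 0)))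
             (subst (_≤ 2 ^ suc N) (2*suc (binary N (b ∘ suc))) (*-monoʳ-≤ 2 (binary<2^ N (b ∘ suc) (bits ∘ suc)))))
    where
    2*suc : ∀ y → 2 * suc y ≡ suc (1 + y * 2)
    2*suc = solve-∀

  binary-ones : ∀ N → suc (binary N (λ _ → 1)) ≡ 2 ^ N
  binary-ones zero    = refl
  binary-ones (suc N) = cong (_+ (2 ^ N + 0)) (binary-ones N)

  wt[2^N∸1]≡N : ∀ N → wt (2 ^ N ∸ 1) ≡ N
  wt[2^N∸1]≡N N = begin
    wt (2 ^ N ∸ 1)                    ≡⟨ cong (λ z → wt (z ∸ 1)) (sym (binary-ones N)) ⟩
    wt (binary N (λ _ → 1))           ≡⟨ wt-binary N _ (λ _ → s≤s z≤n) ⟩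
    Σ< N (λ _ → 1)                    ≡⟨ trans (Σ<-const N 1) (*-identityʳ N) ⟩
    N                                 ∎
    where open ≡-Reasoning

  mod-< : ∀ {x N} → x < N → x mod N ≡ x
  mod-< {N = suc N} x<N = m<n⇒m%n≡m x<N

module Congruence (M : ℕ) where

  open import Data.Integer using (ℤ; +_; -[1+_]; _+_; _*_; -_; _-_; _%ℕ_; _/ℕ_)
  import Data.Integer.Properties as ℤ
  open import Data.Integer.DivMod using (n%ℕd<d; a≡a%ℕn+[a/ℕn]*n)
  open import Data.Integer.Tactic.RingSolver using (solve-∀)
  import Data.Nat as ℕ
  import Data.Nat.Properties as ℕ
  import Data.Nat.DivMod as ℕ
  open import Data.Empty using (⊥-elim)
  open import Relation.Binary.Bundles using (Setoid)
  import Relation.Binary.Reasoning.Setoid as SetoidReasoning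

  infix 4 _≈_
  record _≈_ (a b : ℤ) : Set where
    constructor mk
    field
      quotient : ℤ
      equation : a ≡ b + quotient * + M

  ≈-refl : ∀ {a} → a ≈ a
  ≈-refl {a} = mk (+ 0) (lemma (+ M) a)
    where
    lemma : ∀ m a → a ≡ a + + 0 * m
    lemma = solve-∀

  ≈-sym : ∀ {a b} → a ≈ b → b ≈ a
  ≈-sym {b = b} (mk q refl) = mk (- q) (lemma (+ M) b q)
    where
    lemma : ∀ m b q → b ≡ (b + q * m) + - q * m
    lemma = solve-∀

  ≈-trans : ∀ {a b c} → a ≈ b → b ≈ c → a ≈ c
  ≈-trans {c = c} (mk q refl) (mk p refl) = mk (p + q) (lemma (+ M) c p q)
    where
    lemma : ∀ m c p q → (c + p * m) + q * m ≡ c + (p + q) * m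
    lemma = solve-∀

  ≡⇒≈ : ∀ {a b} → a ≡ b → a ≈ b
  ≡⇒≈ refl = ≈-refl

  +-cong : ∀ {a b c e} → a ≈ b → c ≈ e → a + c ≈ b + e
  +-cong {b = b} {e = e} (mk q refl) (mk p refl) = mk (q + p) (lemma (+ M) b e q p)
    where
    lemma : ∀ m b e q p → (b + q * m) + (e + p * m) ≡ (b + e) + (q + p) * m
    lemma = solve-∀

  *-cong : ∀ {a b c e} → a ≈ b → c ≈ e → a * c ≈ b * e
  *-cong {b = b} {e = e} (mk q refl) (mk p refl) = mk (q * e + b * p + q * p * + M) (lemma (+ M) b e q p)
    where
    lemma : ∀ m b e q p → (b + q * m) * (e + p * m) ≡ (b * e) + (q * e + b * p + q * p * m) * m
    lemma = solve-∀

  -‿cong : ∀ {a b} → a ≈ b → - a ≈ - b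
  -‿cong {b = b} (mk q refl) = mk (- q) (lemma (+ M) b q)
    where
    lemma : ∀ m b q → - (b + q * m) ≡ - b + - q * m
    lemma = solve-∀

  *-congˡ : ∀ a {b c} → b ≈ c → a * b ≈ a * c
  *-congˡ a = *-cong (≈-refl {a})

  *-congʳ : ∀ a {b c} → b ≈ c → b * a ≈ c * a
  *-congʳ a b≈c = *-cong b≈c (≈-refl {a})

  +-congˡ : ∀ a {b c} → b ≈ c → a + b ≈ a + c
  +-congˡ a = +-cong (≈-refl {a})

  +-congʳ : ∀ a {b c} → b ≈ c → b + a ≈ c + a
  +-congʳ a b≈c = +-cong b≈c (≈-refl {a})

  ≈-setoid : Setoid _ _
  ≈-setoid = record
    { Carrier       = ℤ
    ; _≈_           = _≈_
    ; isEquivalence = record { refl = ≈-refl ; sym = ≈-sym ; trans = ≈-trans }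
    }

  module ≈-Reasoning = SetoidReasoning ≈-setoid

  Σ<-cong-≈ : ∀ c {f g : ℕ → ℕ} → (∀ i → i < c → + f i ≈ + g i) → + Σ< c f ≈ + Σ< c g
  Σ<-cong-≈ zero    f≈g = ≈-refl
  Σ<-cong-≈ (suc c) f≈g = +-cong (Σ<-cong-≈ c (λ i i<c → f≈g i (ℕ.m<n⇒m<1+n i<c))) (f≈g c (ℕ.n<1+n c))

  ≈⇒mod≡ : ∀ {x ρ} → ρ < M → + x ≈ + ρ → x mod M ≡ ρ
  ≈⇒mod≡ {x} {ρ} ρ<M (mk q eq) = residue M q ρ<M eq
    where
    residue : ∀ N (q : ℤ) → ρ < N → + x ≡ + ρ + q * + N → x mod N ≡ ρ
    residue (suc N) (+ q) ρ<N eq = begin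
      x ℕ.% suc N
        ≡⟨ cong (ℕ._% suc N) (ℤ.+-injective (trans eq (cong (λ z → + ρ + z) (sym (ℤ.pos-* q (suc N)))))) ⟩
      (ρ ℕ.+ q ℕ.* suc N) ℕ.% suc N    ≡⟨ ℕ.[m+kn]%n≡m%n ρ q (suc N) ⟩
      ρ ℕ.% suc N                      ≡⟨ ℕ.m<n⇒m%n≡m ρ<N ⟩
      ρ                                ∎
      where open ≡-Reasoning
    residue (suc N) -[1+ q ] ρ<N eq = ⊥-elim (ℕ.<⇒≱ ρ<N (begin
      suc N                            ≤⟨ ℕ.m≤n*m (suc N) (suc q) ⟩
      suc q ℕ.* suc N                  ≤⟨ ℕ.m≤n+m _ x ⟩
      x ℕ.+ suc q ℕ.* suc N            ≡⟨ ℤ.+-injective x+[1+q]N≡ρ ⟩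
      ρ                                ∎))
      where
      open ℕ.≤-Reasoning
      move : ∀ X R A B → X ≡ R + (- A) * B → X + A * B ≡ R
      move X R A B refl = lemma R A B
        where
        lemma : ∀ R A B → R + (- A) * B + A * B ≡ R
        lemma = solve-∀
      x+[1+q]N≡ρ : + (x ℕ.+ suc q ℕ.* suc N) ≡ + ρ
      x+[1+q]N≡ρ = trans (cong (λ z → + x + z) (ℤ.pos-* (suc q) (suc N))) (move (+ x) (+ ρ) (+ suc q) (+ suc N) eq)

  x+y≡z+kM⇒x≈z-y : ∀ {x y z} k → x ℕ.+ y ≡ z ℕ.+ k ℕ.* M → + x ≈ + z - + y
  x+y≡z+kM⇒x≈z-y {x} {y} {z} k eq = mk (+ k) (begin
    + x                         ≡⟨ lemma₁ (+ x) (+ y) ⟩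
    (+ x + + y) - + y           ≡⟨ cong (_- + y) eqℤ ⟩
    (+ z + + k * + M) - + y     ≡⟨ lemma₂ (+ z) (+ y) (+ k * + M) ⟩
    (+ z - + y) + + k * + M     ∎)
    where
    open ≡-Reasoning
    eqℤ : + x + + y ≡ + z + + k * + M
    eqℤ = trans (sym (ℤ.pos-+ x y)) (trans (cong +_ eq) (trans (ℤ.pos-+ z (k ℕ.* M)) (cong (λ a → + z + a) (ℤ.pos-* k M))))
    lemma₁ : ∀ x y → x ≡ (x + y) - y
    lemma₁ = solve-∀
    lemma₂ : ∀ z y a → (z + a) - y ≡ (z - y) + a
    lemma₂ = solve-∀

  ≈⇒mod≡%ℕ : ∀ {x e} .{{_ : NonZero M}} → + x ≈ e → x mod M ≡ e %ℕ M
  ≈⇒mod≡%ℕ {x} {e} x≈e = ≈⇒mod≡ (n%ℕd<d e M) (≈-trans x≈e (mk (e /ℕ M) (a≡a%ℕn+[a/ℕn]*n e M)))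

module Mersenne (n : ℕ) where

  open import Data.Nat using (_+_; _*_; _∸_; _^_)
  open import Data.Nat.Properties
  open import Data.Integer as ℤ using (+_)
  import Data.Integer.Properties as ℤ
  open import Relation.Nullary using (¬_)

  M : ℕ
  M = 2 ^ n ∸ 1

  open Congruence M public

  2^n≈1 : + (2 ^ n) ≈ + 1
  2^n≈1 = mk (+ 1) (trans (cong +_ (sym (m+[n∸m]≡n (m^n>0 2 n)))) (cong (λ z → + 1 ℤ.+ z) (sym (ℤ.*-identityˡ (+ M)))))

  [2^n]^k≈1 : ∀ k → + ((2 ^ n) ^ k) ≈ + 1
  [2^n]^k≈1 zero    = ≈-refl
  [2^n]^k≈1 (suc k) = ≈-trans (≡⇒≈ (ℤ.pos-* (2 ^ n) ((2 ^ n) ^ k))) (*-cong 2^n≈1 ([2^n]^k≈1 k))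

  2^[a+k*n]≈2^a : ∀ a k → + (2 ^ (a + k * n)) ≈ + (2 ^ a)
  2^[a+k*n]≈2^a a k = ≈-trans (≡⇒≈ split) (≈-trans (*-congˡ (+ (2 ^ a)) ([2^n]^k≈1 k)) (≡⇒≈ (ℤ.*-identityʳ (+ (2 ^ a)))))
    where
    split : + (2 ^ (a + k * n)) ≡ + (2 ^ a) ℤ.* + ((2 ^ n) ^ k)
    split = begin
      + (2 ^ (a + k * n))          ≡⟨ cong +_ (^-distribˡ-+-* 2 a (k * n)) ⟩
      + (2 ^ a * 2 ^ (k * n))      ≡⟨ cong (λ z → + (2 ^ a * 2 ^ z)) (*-comm k n) ⟩
      + (2 ^ a * 2 ^ (n * k))      ≡⟨ cong (λ z → + (2 ^ a * z)) (sym (^-*-assoc 2 n k)) ⟩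
      + (2 ^ a * (2 ^ n) ^ k)      ≡⟨ ℤ.pos-* (2 ^ a) ((2 ^ n) ^ k) ⟩
      + (2 ^ a) ℤ.* + ((2 ^ n) ^ k) ∎
      where open ≡-Reasoning

  -- The weight conditions exclude x = 0 and x = 2^n - 1.
  binary-isLeastPosInverse : ∀ {a x} → x < 2 ^ n → ¬ wt x ≡ 0 → ¬ wt x ≡ n → + (a * x) ≈ + 1
                             → x mod M ≡ x × IsLeastPosInverse M a (x mod M)
  binary-isLeastPosInverse {a} {x} x<2^n wt≢0 wt≢n ax≈1 = x-mod , 0<x[mod] , x[mod]<M , ax[mod]≡1
    where
    x≢M : ¬ x ≡ M
    x≢M x≡M = wt≢n (trans (cong wt x≡M) (wt[2^N∸1]≡N n))
    x<M : x < M
    x<M = ≤∧≢⇒< (≤-pred (subst (x <_) (sym (m+[n∸m]≡n (m^n>0 2 n))) x<2^n)) x≢M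
    0<x : 0 < x
    0<x = n≢0⇒n>0 (λ x≡0 → wt≢0 (cong wt x≡0))
    x-mod : x mod M ≡ x
    x-mod = mod-< x<M
    0<x[mod] : 0 < x mod M
    0<x[mod] = subst (0 <_) (sym x-mod) 0<x
    x[mod]<M : x mod M < M
    x[mod]<M = subst (_< M) (sym x-mod) x<M
    ax[mod]≡1 : (a * (x mod M)) mod M ≡ 1
    ax[mod]≡1 = trans (cong (λ z → (a * z) mod M) x-mod) (≈⇒mod≡ (≤-trans (s≤s 0<x) x<M) ax≈1)

module _ where

  open import Data.Integer using (ℤ; +_; _+_; _*_; _-_; _^_; _⊖_)
  import Data.Integer.Properties as ℤ
  open import Data.Integer.Tactic.RingSolver using (solve-∀)
  open import Data.List using (List; []; _∷_; length)
  import Data.Nat as ℕ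
  import Data.Nat.Properties as ℕ
  open import Algebra.Properties.CommutativeSemigroup ℕ.*-commutativeSemigroup using (x∙yz≈y∙xz)

  Φ₆ : ℤ → ℤ
  Φ₆ x = x * x - x + + 1

  pos-^ : ∀ a k → + (a ℕ.^ k) ≡ (+ a) ^ k
  pos-^ a zero    = refl
  pos-^ a (suc k) = trans (ℤ.pos-* a (a ℕ.^ k)) (cong (λ z → + a * z) (pos-^ a k))

  K≡Φ₆ : ∀ r → + (K r) ≡ Φ₆ (+ (2 ℕ.^ r))
  K≡Φ₆ r = cong (_+ + 1) (begin
    + (2 ℕ.^ (2 ℕ.* r) ℕ.∸ 2 ℕ.^ r)         ≡⟨ cong (λ z → + (z ℕ.∸ 2 ℕ.^ r)) 2^[2r]≡2^r*2^r ⟩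
    + (2 ℕ.^ r ℕ.* 2 ℕ.^ r ℕ.∸ 2 ℕ.^ r)      ≡⟨ ℤ.⊖-≥ (ℕ.m≤m*n (2 ℕ.^ r) (2 ℕ.^ r) {{ℕ.m^n≢0 2 r}}) ⟨
    2 ℕ.^ r ℕ.* 2 ℕ.^ r ⊖ 2 ℕ.^ r           ≡⟨ ℤ.m-n≡m⊖n (2 ℕ.^ r ℕ.* 2 ℕ.^ r) (2 ℕ.^ r) ⟨
    + (2 ℕ.^ r ℕ.* 2 ℕ.^ r) - + (2 ℕ.^ r)   ≡⟨ cong (_- + (2 ℕ.^ r)) (ℤ.pos-* (2 ℕ.^ r) (2 ℕ.^ r)) ⟩
    + (2 ℕ.^ r) * + (2 ℕ.^ r) - + (2 ℕ.^ r) ∎)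
    where
    open ≡-Reasoning
    2^[2r]≡2^r*2^r : 2 ℕ.^ (2 ℕ.* r) ≡ 2 ℕ.^ r ℕ.* 2 ℕ.^ r
    2^[2r]≡2^r*2^r = trans (cong (2 ℕ.^_) (cong (r ℕ.+_) (ℕ.+-identityʳ r))) (ℕ.^-distribˡ-+-* 2 r r)

  horner : ℤ → List ℕ → ℤ
  horner t []       = + 0
  horner t (a ∷ as) = + a + t * horner t as

  Σ<-nth-pow≡horner : ∀ t L c → length L ≤ c → + Σ< c (λ j → nth L j ℕ.* t ℕ.^ j) ≡ horner (+ t) L
  Σ<-nth-pow≡horner t []      c       _         = cong +_ (trans (Σ<-const c 0) (ℕ.*-zeroʳ c))
  Σ<-nth-pow≡horner t (a ∷ L) (suc c) (s≤s L≤c) = begin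
    + Σ< (suc c) (λ j → nth (a ∷ L) j ℕ.* t ℕ.^ j)
      ≡⟨ cong +_ (Σ<-suc c _) ⟩
    + (a ℕ.* 1 ℕ.+ Σ< c (λ j → nth L j ℕ.* (t ℕ.* t ℕ.^ j)))
      ≡⟨ cong +_ (cong₂ ℕ._+_ (ℕ.*-identityʳ a)
                            (trans (Σ<-cong-≗ c (λ j → x∙yz≈y∙xz (nth L j) t (t ℕ.^ j))) (Σ<-*ˡ c t _))) ⟩
    + (a ℕ.+ t ℕ.* Σ< c (λ j → nth L j ℕ.* t ℕ.^ j))
      ≡⟨ trans (ℤ.pos-+ a _) (cong (λ z → + a + z) (ℤ.pos-* t _)) ⟩
    + a + + t * + Σ< c (λ j → nth L j ℕ.* t ℕ.^ j)
      ≡⟨ cong (λ z → + a + + t * z) (Σ<-nth-pow≡horner t L c L≤c) ⟩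
    horner (+ t) (a ∷ L) ∎
    where
    open ≡-Reasoning

  alt-+-suc : ∀ b p → alt b (suc p ℕ.+ suc p) ≡ alt b (suc (suc (p ℕ.+ p)))
  alt-+-suc b p = cong (λ z → alt b (suc z)) (ℕ.+-suc p p)

  t*horner-alt1 : ∀ t p → t * horner t (alt 1 (p ℕ.+ p)) ≡ horner t (alt 0 (p ℕ.+ p))
  t*horner-alt1 t zero    = ℤ.*-zeroʳ t
  t*horner-alt1 t (suc p) = begin
    t * horner t (alt 1 (suc p ℕ.+ suc p))           ≡⟨ cong (λ z → t * horner t z) (alt-+-suc 1 p) ⟩
    t * (+ 1 + t * (+ 0 + t * horner t (alt 1 (p ℕ.+ p))))
                                                     ≡⟨ cong (λ z → t * (+ 1 + t * (+ 0 + z))) (t*horner-alt1 t p) ⟩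
    t * (+ 1 + t * (+ 0 + horner t (alt 0 (p ℕ.+ p)))) ≡⟨ lemma t _ ⟩
    + 0 + t * (+ 1 + t * horner t (alt 0 (p ℕ.+ p)))  ≡⟨ cong (horner t) (alt-+-suc 0 p) ⟨
    horner t (alt 0 (suc p ℕ.+ suc p))               ∎
    where
    open ≡-Reasoning
    lemma : ∀ t h → t * (+ 1 + t * (+ 0 + h)) ≡ + 0 + t * (+ 1 + t * h)
    lemma = solve-∀

  t*horner-alt0 : ∀ t p → t * horner t (alt 0 (p ℕ.+ p)) + + 1 ≡ horner t (alt 1 (p ℕ.+ p)) + t ^ (p ℕ.+ p)
  t*horner-alt0 t zero    = cong (_+ + 1) (ℤ.*-zeroʳ t)
  t*horner-alt0 t (suc p) = begin
    t * horner t (alt 0 (suc p ℕ.+ suc p)) + + 1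
      ≡⟨ cong (λ z → t * horner t (alt 0 z) + + 1) (cong suc (ℕ.+-suc p p)) ⟩
    t * (+ 0 + t * (+ 1 + t * h₀)) + + 1
      ≡⟨ lemma₁ t h₀ ⟩
    + 1 + t * t * (t * h₀ + + 1)
      ≡⟨ cong (λ z → + 1 + t * t * z) (t*horner-alt0 t p) ⟩
    + 1 + t * t * (h₁ + t ^ (p ℕ.+ p))
      ≡⟨ lemma₂ t h₁ (t ^ (p ℕ.+ p)) ⟩
    (+ 1 + t * (+ 0 + t * h₁)) + t * (t * t ^ (p ℕ.+ p))
      ≡⟨ cong (λ z → horner t (alt 1 z) + t ^ z) (cong suc (ℕ.+-suc p p)) ⟨
    horner t (alt 1 (suc p ℕ.+ suc p)) + t ^ (suc p ℕ.+ suc p) ∎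
    where
    open ≡-Reasoning
    h₀ : ℤ
    h₀ = horner t (alt 0 (p ℕ.+ p))
    h₁ : ℤ
    h₁ = horner t (alt 1 (p ℕ.+ p))
    lemma₁ : ∀ t h → t * (+ 0 + t * (+ 1 + t * h)) + + 1 ≡ + 1 + t * t * (t * h + + 1)
    lemma₁ = solve-∀
    lemma₂ : ∀ t h q → + 1 + t * t * (h + q) ≡ (+ 1 + t * (+ 0 + t * h)) + t * (t * q)
    lemma₂ = solve-∀

  -- Appending a block multiplies the tail by t⁶, so the identity for k + 1 is t⁶ times the
  -- identity for k plus a fixed polynomial identity.
  Φ₆*horner-a₁ᴬ : ∀ t k → Φ₆ t * horner t (1 ∷ 1 ∷ x₁ ^^ k)
                          ≡ t * t + horner t (alt 0 (2 ℕ.+ k ℕ.* 6)) + (+ 1 - t) * (+ 1 - t ^ (2 ℕ.+ k ℕ.* 6))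
  Φ₆*horner-a₁ᴬ t zero    = lemma t
    where
    lemma : ∀ t → (t * t - t + + 1) * (+ 1 + t * (+ 1 + t * + 0))
                  ≡ t * t + (+ 0 + t * (+ 1 + t * + 0)) + (+ 1 - t) * (+ 1 - t * (t * + 1))
    lemma = solve-∀
  Φ₆*horner-a₁ᴬ t (suc k) = begin
    Φ₆ t * horner t (1 ∷ 1 ∷ x₁ ^^ suc k)
      ≡⟨ lemma₁ (Φ₆ t) t e ⟩
    Φ₆ t * δ + t⁶ * (Φ₆ t * horner t (1 ∷ 1 ∷ x₁ ^^ k))
      ≡⟨ cong (λ z → Φ₆ t * δ + t⁶ * z) (Φ₆*horner-a₁ᴬ t k) ⟩
    Φ₆ t * δ + t⁶ * (t * t + h + (+ 1 - t) * (+ 1 - t * (t * q)))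
      ≡⟨ lemma₂ t h q ⟩
    t * t + horner t (alt 0 (2 ℕ.+ suc k ℕ.* 6)) + (+ 1 - t) * (+ 1 - t ^ (2 ℕ.+ suc k ℕ.* 6)) ∎
    where
    open ≡-Reasoning
    t⁶ : ℤ
    t⁶ = t * t * t * t * t * t
    δ : ℤ
    δ = + 1 + t + t * t + t * t * t - t⁶
    e : ℤ
    e = horner t (x₁ ^^ k)
    h : ℤ
    h = horner t (alt 0 (2 ℕ.+ k ℕ.* 6))
    q : ℤ
    q = t ^ (k ℕ.* 6)
    lemma₁ : ∀ φ t e → φ * (+ 1 + t * (+ 1 + t * (+ 1 + t * (+ 1 + t * (+ 0 + t * (+ 0 + t * (+ 0 + t * (+ 1 + t * e))))))))
                       ≡ φ * (+ 1 + t + t * t + t * t * t - t * t * t * t * t * t) + t * t * t * t * t * t * (φ * (+ 1 + t * (+ 1 + t * e)))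
    lemma₁ = solve-∀
    lemma₂ : ∀ t h q → (t * t - t + + 1) * (+ 1 + t + t * t + t * t * t - t * t * t * t * t * t)
                       + t * t * t * t * t * t * (t * t + h + (+ 1 - t) * (+ 1 - t * (t * q)))
                       ≡ t * t + (+ 0 + t * (+ 1 + t * (+ 0 + t * (+ 1 + t * (+ 0 + t * (+ 1 + t * h))))))
                         + (+ 1 - t) * (+ 1 - t * (t * (t * (t * (t * (t * (t * (t * q))))))))
    lemma₂ = solve-∀

  Φ₆*horner-a₁ᴮ : ∀ t k → Φ₆ t * horner t (1 ∷ 0 ∷ 1 ∷ 1 ∷ x₂ ^^ k)
                          ≡ t * t + horner t (alt 1 (4 ℕ.+ k ℕ.* 6)) + t * (t ^ (4 ℕ.+ k ℕ.* 6) - + 1)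
  Φ₆*horner-a₁ᴮ t zero    = lemma t
    where
    lemma : ∀ t → (t * t - t + + 1) * (+ 1 + t * (+ 0 + t * (+ 1 + t * (+ 1 + t * + 0))))
                  ≡ t * t + (+ 1 + t * (+ 0 + t * (+ 1 + t * (+ 0 + t * + 0))))
                    + t * (t * (t * (t * (t * + 1))) - + 1)
    lemma = solve-∀
  Φ₆*horner-a₁ᴮ t (suc k) = begin
    Φ₆ t * horner t (1 ∷ 0 ∷ 1 ∷ 1 ∷ x₂ ^^ suc k)
      ≡⟨ lemma₁ (Φ₆ t) t e ⟩
    Φ₆ t * δ + t⁶ * (Φ₆ t * horner t (1 ∷ 0 ∷ 1 ∷ 1 ∷ x₂ ^^ k))
      ≡⟨ cong (λ z → Φ₆ t * δ + t⁶ * z) (Φ₆*horner-a₁ᴮ t k) ⟩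
    Φ₆ t * δ + t⁶ * (t * t + h + t * (t * (t * (t * (t * q))) - + 1))
      ≡⟨ lemma₂ t h q ⟩
    t * t + horner t (alt 1 (4 ℕ.+ suc k ℕ.* 6)) + t * (t ^ (4 ℕ.+ suc k ℕ.* 6) - + 1) ∎
    where
    open ≡-Reasoning
    t⁶ : ℤ
    t⁶ = t * t * t * t * t * t
    δ : ℤ
    δ = + 1 + t * t + t * t * t + t * t * t * t - t⁶
    e : ℤ
    e = horner t (x₂ ^^ k)
    h : ℤ
    h = horner t (alt 1 (4 ℕ.+ k ℕ.* 6))
    q : ℤ
    q = t ^ (k ℕ.* 6)
    lemma₁ : ∀ φ t e → φ * (+ 1 + t * (+ 0 + t * (+ 1 + t * (+ 1 + t * (+ 1 + t * (+ 0 + t * (+ 0 + t * (+ 0 + t * (+ 1 + t * (+ 1 + t * e))))))))))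
                       ≡ φ * (+ 1 + t * t + t * t * t + t * t * t * t - t * t * t * t * t * t)
                         + t * t * t * t * t * t * (φ * (+ 1 + t * (+ 0 + t * (+ 1 + t * (+ 1 + t * e)))))
    lemma₁ = solve-∀
    lemma₂ : ∀ t h q → (t * t - t + + 1) * (+ 1 + t * t + t * t * t + t * t * t * t - t * t * t * t * t * t)
                       + t * t * t * t * t * t * (t * t + h + t * (t * (t * (t * (t * q))) - + 1))
                       ≡ t * t + (+ 1 + t * (+ 0 + t * (+ 1 + t * (+ 0 + t * (+ 1 + t * (+ 0 + t * h))))))
                         + t * (t * (t * (t * (t * (t * (t * (t * (t * (t * (t * q))))))))) - + 1)
    lemma₂ = solve-∀

module _ where

  open import Data.Nat using (_+_; _*_; _∸_)
  open import Data.Nat.Properties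
  open import Data.List using (List; []; _∷_; length)
  open import Data.List.Properties using (length-++)
  open import Data.Nat.ListAction using (sum)
  open import Data.Nat.ListAction.Properties using (sum-++)
  open import Data.List.Relation.Unary.All using (All; []; _∷_)
  open import Data.List.Relation.Unary.All.Properties using (++⁺)

  length-^^ : ∀ (u : List ℕ) k → length (u ^^ k) ≡ k * length u
  length-^^ u zero    = refl
  length-^^ u (suc k) = trans (length-++ u) (cong (length u +_) (length-^^ u k))

  sum-^^ : ∀ u k → sum (u ^^ k) ≡ k * sum u
  sum-^^ u zero    = refl
  sum-^^ u (suc k) = trans (sum-++ u (u ^^ k)) (cong (sum u +_) (sum-^^ u k))

  All-^^ : ∀ {P : ℕ → Set} {u} k → All P u → All P (u ^^ k)
  All-^^ zero    pu = []
  All-^^ (suc k) pu = ++⁺ pu (All-^^ k pu)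

  length-alt : ∀ b m → length (alt b m) ≡ m
  length-alt b zero    = refl
  length-alt b (suc m) = cong suc (length-alt (1 ∸ b) m)

  sum-alt : ∀ {b} p → b ≤ 1 → sum (alt b (p + p)) ≡ p
  sum-alt {b} zero    b≤1 = refl
  sum-alt {b} (suc p) b≤1 = begin
    sum (alt b (suc p + suc p))                   ≡⟨ cong (λ z → sum (alt b (suc z))) (+-suc p p) ⟩
    b + (1 ∸ b + sum (alt (1 ∸ (1 ∸ b)) (p + p))) ≡⟨ cong (λ c → b + (1 ∸ b + sum (alt c (p + p)))) (m∸[m∸n]≡n b≤1) ⟩
    b + (1 ∸ b + sum (alt b (p + p)))             ≡⟨ sym (+-assoc b (1 ∸ b) _) ⟩
    b + (1 ∸ b) + sum (alt b (p + p))             ≡⟨ cong₂ _+_ (m+[n∸m]≡n b≤1) (sum-alt p b≤1) ⟩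
    suc p                                         ∎
    where
    open ≡-Reasoning

  All-alt : ∀ {b} m → b ≤ 1 → All (_≤ 1) (alt b m)
  All-alt     zero    b≤1 = []
  All-alt {b} (suc m) b≤1 = b≤1 ∷ All-alt m (m∸n≤m 1 b)

  nth-All : ∀ {P : ℕ → Set} {L} → P 0 → All P L → ∀ j → P (nth L j)
  nth-All p0 []         j       = p0
  nth-All p0 (pa ∷ pas) zero    = pa
  nth-All p0 (pa ∷ pas) (suc j) = nth-All p0 pas j

  Σ<-nth : ∀ L c → length L ≤ c → Σ< c (nth L) ≡ sum L
  Σ<-nth []      c       _         = trans (Σ<-const c 0) (*-zeroʳ c)
  Σ<-nth (a ∷ L) (suc c) (s≤s L≤c) = trans (Σ<-suc c (nth (a ∷ L))) (cong (a +_) (Σ<-nth L c L≤c))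

  rowOf-odd : ∀ a₁ x y q → rowOf a₁ x y (suc (q * 2)) ≡ x
  rowOf-odd a₁ x y zero    = refl
  rowOf-odd a₁ x y (suc q) = rowOf-odd y x y q

  rowOf-even : ∀ a₁ x y q → rowOf a₁ x y (suc (suc (q * 2))) ≡ y
  rowOf-even a₁ x y zero    = refl
  rowOf-even a₁ x y (suc q) = rowOf-even y x y q

  rowOf-All : ∀ (P : List ℕ → Set) {a₁ x y} → P a₁ → P x → P y → ∀ i → P (rowOf a₁ x y i)
  rowOf-All P pa px py zero          = pa
  rowOf-All P pa px py (suc zero)    = px
  rowOf-All P pa px py (suc (suc i)) = rowOf-All P py px py i

  rowOf-All-suc : ∀ (P : List ℕ → Set) {a₁ x y} → P x → P y → ∀ i → P (rowOf a₁ x y (suc i))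
  rowOf-All-suc P px py zero    = px
  rowOf-All-suc P px py (suc i) = rowOf-All P py px py i

  Σ<-rowOf : ∀ {a₁ x y m s} c → length a₁ ≤ m → length x ≤ m → length y ≤ m → sum x ≡ s → sum y ≡ s
             → Σ< (suc c) (λ i → Σ< m (nth (rowOf a₁ x y i))) ≡ sum a₁ + c * s
  Σ<-rowOf {a₁} {x} {y} {m} {s} c a₁≤m x≤m y≤m Σx Σy = begin
    Σ< (suc c) (λ i → Σ< m (nth (rowOf a₁ x y i)))                ≡⟨ Σ<-suc c _ ⟩
    Σ< m (nth a₁) + Σ< c (λ i → Σ< m (nth (rowOf a₁ x y (suc i)))) ≡⟨ cong₂ _+_ (Σ<-nth a₁ m a₁≤m) (Σ<-cong-≗ c rowSum) ⟩
    sum a₁ + Σ< c (λ _ → s)                                       ≡⟨ cong (sum a₁ +_) (Σ<-const c s) ⟩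
    sum a₁ + c * s                                                ∎
    where
    open ≡-Reasoning
    rowSum : ∀ i → Σ< m (nth (rowOf a₁ x y (suc i))) ≡ s
    rowSum = rowOf-All-suc (λ L → Σ< m (nth L) ≡ s) (trans (Σ<-nth x m x≤m) Σx) (trans (Σ<-nth y m y≤m) Σy)

module Φ₆-Congruences (M : ℕ) where

  open import Data.Integer using (ℤ; +_; _+_; _*_; -_; _-_)
  import Data.Integer.Properties as ℤ
  open import Data.Integer.Tactic.RingSolver using (solve-∀)
  import Data.Nat as ℕ
  open Congruence M
  open ≈-Reasoning

  Φ₆-pair : ∀ t {u v} → t * u ≈ v → t * v ≈ u → Φ₆ t * u ≈ + 2 * u - v
  Φ₆-pair t {u} {v} tu≈v tv≈u = begin
    Φ₆ t * u                  ≡⟨ lemma₁ t u ⟩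
    t * (t * u) - t * u + u   ≈⟨ +-congʳ u (+-cong (*-congˡ t tu≈v) (-‿cong tu≈v)) ⟩
    t * v - v + u             ≈⟨ +-congʳ u (+-congʳ (- v) tv≈u) ⟩
    u - v + u                 ≡⟨ lemma₂ u v ⟩
    + 2 * u - v               ∎
    where
    lemma₁ : ∀ t u → (t * t - t + + 1) * u ≡ t * (t * u) - t * u + u
    lemma₁ = solve-∀
    lemma₂ : ∀ u v → u - v + u ≡ + 2 * u - v
    lemma₂ = solve-∀

  -- Φ₆(s) t² = (s t)² - (s t) t + t², which is Φ₆(t) when s t ≈ 1.
  Φ₆-inverse : ∀ {s t z} → s * t ≈ + 1 → Φ₆ t * z ≈ t * t → Φ₆ s * z ≈ + 1
  Φ₆-inverse {s} {t} {z} st≈1 Φ₆[t]z≈t² = begin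
    Φ₆ s * z                                         ≡⟨ lemma₁ (Φ₆ s * z) ⟩
    Φ₆ s * z * (+ 1 * + 1)                           ≈⟨ *-congˡ (Φ₆ s * z) (*-cong (≈-sym st≈1) (≈-sym st≈1)) ⟩
    Φ₆ s * z * ((s * t) * (s * t))                   ≡⟨ lemma₂ s t z ⟩
    s * s * ((s * t) * (s * t) - (s * t) * t + t * t) * z
      ≈⟨ *-congʳ z (*-congˡ (s * s) (+-congʳ (t * t) (+-cong (*-cong st≈1 st≈1) (-‿cong (*-congʳ t st≈1))))) ⟩
    s * s * (+ 1 * + 1 - + 1 * t + t * t) * z        ≡⟨ lemma₃ s t z ⟩
    s * s * (Φ₆ t * z)                               ≈⟨ *-congˡ (s * s) Φ₆[t]z≈t² ⟩
    s * s * (t * t)                                  ≡⟨ lemma₄ s t ⟩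
    (s * t) * (s * t)                                ≈⟨ *-cong st≈1 st≈1 ⟩
    + 1                                              ∎
    where
    lemma₁ : ∀ a → a ≡ a * (+ 1 * + 1)
    lemma₁ = solve-∀
    lemma₂ : ∀ s t z → (s * s - s + + 1) * z * ((s * t) * (s * t)) ≡ s * s * ((s * t) * (s * t) - (s * t) * t + t * t) * z
    lemma₂ = solve-∀
    lemma₃ : ∀ s t z → s * s * (+ 1 * + 1 - + 1 * t + t * t) * z ≡ s * s * ((t * t - t + + 1) * z)
    lemma₃ = solve-∀
    lemma₄ : ∀ s t → s * s * (t * t) ≡ (s * t) * (s * t)
    lemma₄ = solve-∀

  -- Φ₆ t acts on the row values as u ↦ 2u - v, so the rows 2q + 1 and 2q + 2
  -- contribute 2^(2q+3) v - 2^(2q+1) v, and these contributions telescope.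
  Φ₆-rowSum : ∀ t (R : ℕ → ℕ) {U V} → (∀ q → R (suc (q ℕ.* 2)) ≡ U) → (∀ q → R (suc (suc (q ℕ.* 2))) ≡ V)
              → Φ₆ t * + U ≈ + 2 * + U - + V → Φ₆ t * + V ≈ + 2 * + V - + U
              → ∀ q → Φ₆ t * + Σ< (2 ℕ.+ q ℕ.* 2) (λ i → 2 ℕ.^ i ℕ.* R i)
                      ≈ Φ₆ t * + R 0 + + (2 ℕ.^ (2 ℕ.+ q ℕ.* 2)) * + U - + 2 * + V
  Φ₆-rowSum t R {U} {V} R-odd R-even Φ₆U Φ₆V = go
    where
    F : ℕ → ℕ
    F i = 2 ℕ.^ i ℕ.* R i
    term : ∀ i {W} → R i ≡ W → + F i ≡ + (2 ℕ.^ i) * + W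
    term i {W} Ri≡W = trans (ℤ.pos-* (2 ℕ.^ i) (R i)) (cong (λ w → + (2 ℕ.^ i) * + w) Ri≡W)
    go : ∀ q → Φ₆ t * + Σ< (2 ℕ.+ q ℕ.* 2) F ≈ Φ₆ t * + R 0 + + (2 ℕ.^ (2 ℕ.+ q ℕ.* 2)) * + U - + 2 * + V
    go zero = begin
      Φ₆ t * (+ 0 + + F 0 + + F 1)         ≡⟨ cong₂ (λ a b → Φ₆ t * (+ 0 + a + b)) (term 0 refl) (term 1 (R-odd 0)) ⟩
      Φ₆ t * (+ 0 + + 1 * + R 0 + + 2 * + U) ≡⟨ lemma₁ (Φ₆ t) (+ R 0) (+ U) ⟩
      Φ₆ t * + R 0 + + 2 * (Φ₆ t * + U)     ≈⟨ +-congˡ (Φ₆ t * + R 0) (*-congˡ (+ 2) Φ₆U) ⟩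
      Φ₆ t * + R 0 + + 2 * (+ 2 * + U - + V) ≡⟨ lemma₂ (Φ₆ t * + R 0) (+ U) (+ V) ⟩
      Φ₆ t * + R 0 + + 4 * + U - + 2 * + V   ∎
      where
      lemma₁ : ∀ φ r u → φ * (+ 0 + + 1 * r + + 2 * u) ≡ φ * r + + 2 * (φ * u)
      lemma₁ = solve-∀
      lemma₂ : ∀ a u v → a + + 2 * (+ 2 * u - v) ≡ a + + 4 * u - + 2 * v
      lemma₂ = solve-∀
    go (suc q) = begin
      Φ₆ t * (+ Σ< c F + + F c + + F (suc c))
        ≡⟨ cong₂ (λ a b → Φ₆ t * (+ Σ< c F + a + b)) (term c (R-even q))
                 (trans (term (suc c) (R-odd (suc q))) (cong (_* + U) (ℤ.pos-* 2 (2 ℕ.^ c)))) ⟩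
      Φ₆ t * (+ Σ< c F + p * + V + + 2 * p * + U)
        ≡⟨ lemma₁ (Φ₆ t) (+ Σ< c F) p (+ U) (+ V) ⟩
      Φ₆ t * + Σ< c F + p * (Φ₆ t * + V) + + 2 * p * (Φ₆ t * + U)
        ≈⟨ +-cong (+-cong (go q) (*-congˡ p Φ₆V)) (*-congˡ (+ 2 * p) Φ₆U) ⟩
      (Φ₆ t * + R 0 + p * + U - + 2 * + V) + p * (+ 2 * + V - + U) + + 2 * p * (+ 2 * + U - + V)
        ≡⟨ lemma₂ (Φ₆ t * + R 0) p (+ U) (+ V) ⟩
      Φ₆ t * + R 0 + + 2 * (+ 2 * p) * + U - + 2 * + V
        ≡⟨ cong (λ a → Φ₆ t * + R 0 + a * + U - + 2 * + V)
                (trans (ℤ.pos-* 2 (2 ℕ.^ suc c)) (cong (+ 2 *_) (ℤ.pos-* 2 (2 ℕ.^ c)))) ⟨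
      Φ₆ t * + R 0 + + (2 ℕ.^ suc (suc c)) * + U - + 2 * + V ∎
      where
      c : ℕ
      c = 2 ℕ.+ q ℕ.* 2
      p : ℤ
      p = + (2 ℕ.^ c)
      lemma₁ : ∀ φ s p u v → φ * (s + p * v + + 2 * p * u) ≡ φ * s + p * (φ * v) + + 2 * p * (φ * u)
      lemma₁ = solve-∀
      lemma₂ : ∀ a p u v → (a + p * u - + 2 * v) + p * (+ 2 * v - u) + + 2 * p * (+ 2 * u - v) ≡ a + + 2 * (+ 2 * p) * u - + 2 * v
      lemma₂ = solve-∀

module _ where

  open import Data.Nat using (_+_; _*_; _/_; _%_)
  open import Data.Nat.Properties
  open import Data.Nat.DivMod hiding (_mod_)
  open import Data.Nat.Divisibility using (_∣_; divides; ∣m+n∣m⇒∣n; ∣1⇒≡1; ∣n⇒∣m*n; ∣m⇒∣m*n)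
  open import Data.Nat.GCD using (module Bézout)
  open import Data.Nat.Coprimality using (Coprime; coprime-Bézout)
  open import Data.Nat.Tactic.RingSolver using (solve-∀)

  %-inverse : ∀ {m a b c} .{{_ : NonZero m}} → a * b ≡ 1 + m * c → ∀ l → l < m → ((l * a) % m * b) % m ≡ l
  %-inverse {m} {a} {b} {c} ab≡1+mc l l<m = begin
    ((l * a) % m * b) % m          ≡⟨ %-distribˡ-* ((l * a) % m) b m ⟩
    ((l * a) % m % m * (b % m)) % m ≡⟨ cong (λ z → (z * (b % m)) % m) (m%n%n≡m%n (l * a) m) ⟩
    ((l * a) % m * (b % m)) % m    ≡⟨ %-distribˡ-* (l * a) b m ⟨
    (l * a * b) % m                ≡⟨ cong (_% m) (trans (*-assoc l a b) (cong (l *_) ab≡1+mc)) ⟩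
    (l * (1 + m * c)) % m          ≡⟨ cong (_% m) (lemma l m c) ⟩
    (l + l * c * m) % m            ≡⟨ [m+kn]%n≡m%n l (l * c) m ⟩
    l % m                          ≡⟨ m<n⇒m%n≡m l<m ⟩
    l                              ∎
    where
    open ≡-Reasoning
    lemma : ∀ l m c → l * (1 + m * c) ≡ l + l * c * m
    lemma = solve-∀

  odd-factor : ∀ {m a b c} → 2 ∣ m → a * b ≡ 1 + m * c → ∃ λ e → b ≡ 1 + e * 2
  odd-factor {m} {a} {b} {c} 2∣m ab≡1+mc with b % 2 | m%n<n b 2 | m≡m%n+[m/n]*n b 2
  ... | 0 | _ | b≡[b/2]*2 = contradiction (∣1⇒≡1 2∣1) λ ()
    where
    2∣1 : 2 ∣ 1
    2∣1 = ∣m+n∣m⇒∣n (subst (2 ∣_) (trans ab≡1+mc (+-comm 1 (m * c))) (∣n⇒∣m*n a (divides (b / 2) b≡[b/2]*2)))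
                    (∣m⇒∣m*n c 2∣m)
  ... | 1 | _ | b≡1+[b/2]*2 = b / 2 , b≡1+[b/2]*2
  ... | suc (suc _) | s≤s (s≤s ()) | _

  inverse-of-negation : ∀ {a k} → Coprime a (2 + k) → ∃ λ v → ∃ λ c → a * (1 + k) * v ≡ 1 + (2 + k) * c
  inverse-of-negation {a} {k} a⊥m with coprime-Bézout a⊥m
  ... | Bézout.+- x y 1+ym≡xa = x * (1 + k) , k + y * (1 + k) * (1 + k) , (begin
    a * (1 + k) * (x * (1 + k))                ≡⟨ lemma₁ a k x ⟩
    x * a * ((1 + k) * (1 + k))                ≡⟨ cong (_* ((1 + k) * (1 + k))) 1+ym≡xa ⟨
    (1 + y * (2 + k)) * ((1 + k) * (1 + k))    ≡⟨ lemma₂ y k ⟩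
    1 + (2 + k) * (k + y * (1 + k) * (1 + k))  ∎)
    where
    open ≡-Reasoning
    lemma₁ : ∀ a k x → a * (1 + k) * (x * (1 + k)) ≡ x * a * ((1 + k) * (1 + k))
    lemma₁ = solve-∀
    lemma₂ : ∀ y k → (1 + y * (2 + k)) * ((1 + k) * (1 + k)) ≡ 1 + (2 + k) * (k + y * (1 + k) * (1 + k))
    lemma₂ = solve-∀
  ... | Bézout.-+ x zero    ()
  ... | Bézout.-+ x (suc y) 1+xa≡[1+y]m = x , k + y * (1 + k) , (begin
    a * (1 + k) * x                    ≡⟨ lemma₁ a k x ⟩
    x * a * (1 + k)                    ≡⟨ cong (_* (1 + k)) xa≡1+k+ym ⟩
    ((1 + k) + y * (2 + k)) * (1 + k)  ≡⟨ lemma₂ y k ⟩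
    1 + (2 + k) * (k + y * (1 + k))    ∎)
    where
    open ≡-Reasoning
    lemma₀ : ∀ y k → suc y * (2 + k) ≡ suc ((1 + k) + y * (2 + k))
    lemma₀ = solve-∀
    xa≡1+k+ym : x * a ≡ (1 + k) + y * (2 + k)
    xa≡1+k+ym = suc-injective (trans 1+xa≡[1+y]m (lemma₀ y k))
    lemma₁ : ∀ a k x → a * (1 + k) * x ≡ x * a * (1 + k)
    lemma₁ = solve-∀
    lemma₂ : ∀ y k → ((1 + k) + y * (2 + k)) * (1 + k) ≡ 1 + (2 + k) * (k + y * (1 + k))
    lemma₂ = solve-∀

module Exponents (h q r′ : ℕ) where

  open import Data.Nat using (_+_; _*_; _^_; _/_; _%_)
  open import Data.Nat.Properties
  open import Data.Nat.DivMod hiding (_mod_)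
  open import Data.Nat.Tactic.RingSolver using (solve-∀)
  open import Data.Nat.Divisibility using (divides)
  open import Data.Integer as ℤ using (+_)

  -- d = gcd(r, n) and m = n/d are even, r = r′ d; w ≡ -r′ (mod m), so 2^(d w) inverts 2^r.
  m d n r w : ℕ
  m = 2 + h * 2
  d = 2 + q * 2
  n = m * d
  r = r′ * d
  w = r′ * (1 + h * 2)

  column : ℕ → ℕ
  column j = (j * w) % m

  r+d*w≡r′*n : r + d * w ≡ r′ * n
  r+d*w≡r′*n = lemma r′ h q
    where
    lemma : ∀ r′ h q → r′ * (2 + q * 2) + (2 + q * 2) * (r′ * (1 + h * 2)) ≡ r′ * ((2 + h * 2) * (2 + q * 2))
    lemma = solve-∀

  d*w*m≡w*n : d * w * m ≡ w * n
  d*w*m≡w*n = lemma (2 + q * 2) w (2 + h * 2)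
    where
    lemma : ∀ d w m → d * w * m ≡ w * (m * d)
    lemma = solve-∀

  i+d*w*j≡column+k*n : ∀ i j → i + d * w * j ≡ (column j * d + i) + (j * w) / m * n
  i+d*w*j≡column+k*n i j = begin
    i + d * w * j                           ≡⟨ cong (λ z → i + z) (trans (*-assoc d w j) (cong (d *_) (*-comm w j))) ⟩
    i + d * (j * w)                         ≡⟨ cong (λ z → i + d * z) (m≡m%n+[m/n]*n (j * w) m) ⟩
    i + d * (column j + (j * w) / m * m)    ≡⟨ lemma i d (column j) ((j * w) / m) m ⟩
    (column j * d + i) + (j * w) / m * n    ∎
    where
    open ≡-Reasoning
    lemma : ∀ i d y k m → i + d * (y + k * m) ≡ (y * d + i) + k * (m * d)
    lemma = solve-∀

  pow2-exponent : ∀ i j → i < d → pow2 n (+ i ℤ.- + (j * r)) ≡ 2 ^ (column j * d + i)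
  pow2-exponent i j i<d = cong (2 ^_) (begin
    (+ i ℤ.- + (j * r)) ℤ.%ℕ n   ≡⟨ ≈⇒mod≡%ℕ (x+y≡z+kM⇒x≈z-y {j * w * d + i} {j * r} (j * r′) (lemma j r′ h q i)) ⟨
    (j * w * d + i) % n          ≡⟨ [m*n+o]%[p*n]≡[m*n]%[p*n]+o (j * w) m i<d ⟩
    (j * w * d) % n + i          ≡⟨ cong (_+ i) (m%n*o≡m*o%[n*o] (j * w) m d) ⟨
    column j * d + i             ∎)
    where
    open ≡-Reasoning
    open Congruence n using (x+y≡z+kM⇒x≈z-y; ≈⇒mod≡%ℕ)
    lemma : ∀ j r′ h q i → j * (r′ * (1 + h * 2)) * (2 + q * 2) + i + j * (r′ * (2 + q * 2))
                           ≡ i + j * r′ * ((2 + h * 2) * (2 + q * 2))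
    lemma = solve-∀

  module Inverse (v c : ℕ) (w*v≡1+m*c : w * v ≡ 1 + m * c) where

    column⁻¹ : ℕ → ℕ
    column⁻¹ l = (l * v) % m

    column∘column⁻¹ : ∀ l → l < m → column (column⁻¹ l) ≡ l
    column∘column⁻¹ = %-inverse {c = c} (trans (*-comm v w) w*v≡1+m*c)

    column⁻¹∘column : ∀ j → j < m → column⁻¹ (column j) ≡ j
    column⁻¹∘column = %-inverse {c = c} w*v≡1+m*c

    Σ<-column : ∀ f → Σ< m (f ∘ column) ≡ Σ< m f
    Σ<-column = Σ<-permute m column column⁻¹ (λ j _ → m%n<n (j * w) m) (λ l _ → m%n<n (l * v) m)
                           column∘column⁻¹ column⁻¹∘column

    Σ<-column⁻¹ : ∀ f → Σ< m (f ∘ column⁻¹) ≡ Σ< m f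
    Σ<-column⁻¹ = Σ<-permute m column⁻¹ column (λ l _ → m%n<n (l * v) m) (λ j _ → m%n<n (j * w) m)
                             column⁻¹∘column column∘column⁻¹

    v-odd : ∃ λ e → v ≡ 1 + e * 2
    v-odd = odd-factor {a = w} {c = c} (divides (1 + h) (lemma h)) w*v≡1+m*c
      where
      lemma : ∀ h → 2 + h * 2 ≡ (1 + h) * 2
      lemma = solve-∀

    d*w*v≡d+c*n : d * w * v ≡ d + c * n
    d*w*v≡d+c*n = begin
      d * w * v           ≡⟨ *-assoc d w v ⟩
      d * (w * v)         ≡⟨ cong (d *_) w*v≡1+m*c ⟩
      d * (1 + m * c)     ≡⟨ lemma d m c ⟩
      d + c * n           ∎
      where
      open ≡-Reasoning
      lemma : ∀ d m c → d * (1 + m * c) ≡ d + c * (m * d)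
      lemma = solve-∀

    -- The entry a i j of the matrix sits at bit (column j) * d + i of S.
    digit : (ℕ → ℕ → ℕ) → ℕ → ℕ
    digit a e = a (e % d) (column⁻¹ (e / d))

    S≡binary : ∀ a → S n r d m a ≡ binary n (digit a)
    S≡binary a = begin
      S n r d m a
        ≡⟨ Σ<-cong d (λ i i<d → Σ<-cong-≗ m (λ j → cong (a i j *_) (pow2-exponent i j i<d))) ⟩
      Σ< d (λ i → Σ< m (λ j → a i j * 2 ^ (column j * d + i)))
        ≡⟨ Σ<-cong-≗ d (λ i → trans (Σ<-cong m (λ j j<m → cong (λ z → a i z * 2 ^ (column j * d + i)) (sym (column⁻¹∘column j j<m))))
                                    (Σ<-column (λ l → a i (column⁻¹ l) * 2 ^ (l * d + i)))) ⟩
      Σ< d (λ i → Σ< m (λ l → a i (column⁻¹ l) * 2 ^ (l * d + i)))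
        ≡⟨ Σ<-divMod m d (λ i l → a i (column⁻¹ l) * 2 ^ (l * d + i)) ⟨
      Σ< n (λ e → digit a e * 2 ^ (e / d * d + e % d))
        ≡⟨ Σ<-cong-≗ n (λ e → cong (λ z → digit a e * 2 ^ z) (trans (+-comm (e / d * d) (e % d)) (sym (m≡m%n+[m/n]*n e d)))) ⟩
      binary n (digit a) ∎
      where open ≡-Reasoning

    wt-S : ∀ a → (∀ i j → a i j ≤ 1) → wt (S n r d m a) ≡ Σ< d (λ i → Σ< m (a i))
    wt-S a bits = begin
      wt (S n r d m a)                       ≡⟨ cong wt (S≡binary a) ⟩
      wt (binary n (digit a))                ≡⟨ wt-binary n (digit a) (λ e → bits (e % d) (column⁻¹ (e / d))) ⟩
      Σ< n (digit a)                         ≡⟨ Σ<-divMod m d (λ i l → a i (column⁻¹ l)) ⟩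
      Σ< d (λ i → Σ< m (a i ∘ column⁻¹))     ≡⟨ Σ<-cong-≗ d (λ i → Σ<-column⁻¹ (a i)) ⟩
      Σ< d (λ i → Σ< m (a i))                ∎
      where open ≡-Reasoning

    S<2^n : ∀ a → (∀ i j → a i j ≤ 1) → S n r d m a < 2 ^ n
    S<2^n a bits = subst (_< 2 ^ n) (sym (S≡binary a)) (binary<2^ n (digit a) (λ e → bits (e % d) (column⁻¹ (e / d))))

module Residues (h q r′ : ℕ) where

  open import Data.Integer using (ℤ; +_; _+_; _*_; -_; _-_; _^_)
  import Data.Integer.Properties as ℤ
  open import Data.Integer.Tactic.RingSolver using (solve-∀)
  open import Data.List using (List; length)
  import Data.Nat as ℕ
  import Data.Nat.Properties as ℕ
  import Data.Nat.Tactic.RingSolver as ℕ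
  open import Algebra.Properties.CommutativeSemigroup ℕ.*-commutativeSemigroup using (x∙yz≈y∙xz)
  open Exponents h q r′
  open Mersenne n
  open Φ₆-Congruences M
  open ≈-Reasoning

  T : ℕ
  T = 2 ℕ.^ (d ℕ.* w)

  t : ℤ
  t = + T

  2^r*t≈1 : + (2 ℕ.^ r) * t ≈ + 1
  2^r*t≈1 = begin
    + (2 ℕ.^ r) * t              ≡⟨ ℤ.pos-* (2 ℕ.^ r) T ⟨
    + (2 ℕ.^ r ℕ.* T)            ≡⟨ cong +_ (ℕ.^-distribˡ-+-* 2 r (d ℕ.* w)) ⟨
    + (2 ℕ.^ (r ℕ.+ d ℕ.* w))    ≡⟨ cong (λ e → + (2 ℕ.^ e)) r+d*w≡r′*n ⟩
    + (2 ℕ.^ (0 ℕ.+ r′ ℕ.* n))   ≈⟨ 2^[a+k*n]≈2^a 0 r′ ⟩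
    + 1                          ∎

  t^m≈1 : t ^ m ≈ + 1
  t^m≈1 = begin
    t ^ m                        ≡⟨ pos-^ T m ⟨
    + (T ℕ.^ m)                  ≡⟨ cong +_ (ℕ.^-*-assoc 2 (d ℕ.* w) m) ⟩
    + (2 ℕ.^ (d ℕ.* w ℕ.* m))    ≡⟨ cong (λ e → + (2 ℕ.^ e)) d*w*m≡w*n ⟩
    + (2 ℕ.^ (0 ℕ.+ w ℕ.* n))    ≈⟨ 2^[a+k*n]≈2^a 0 w ⟩
    + 1                          ∎

  2^[column*d+i]≈2^i*T^j : ∀ i j → + (2 ℕ.^ (column j ℕ.* d ℕ.+ i)) ≈ + (2 ℕ.^ i ℕ.* T ℕ.^ j)
  2^[column*d+i]≈2^i*T^j i j = ≈-sym (begin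
    + (2 ℕ.^ i ℕ.* T ℕ.^ j)                ≡⟨ cong (λ z → + (2 ℕ.^ i ℕ.* z)) (ℕ.^-*-assoc 2 (d ℕ.* w) j) ⟩
    + (2 ℕ.^ i ℕ.* 2 ℕ.^ (d ℕ.* w ℕ.* j))   ≡⟨ cong +_ (ℕ.^-distribˡ-+-* 2 i (d ℕ.* w ℕ.* j)) ⟨
    + (2 ℕ.^ (i ℕ.+ d ℕ.* w ℕ.* j))         ≡⟨ cong (λ e → + (2 ℕ.^ e)) (i+d*w*j≡column+k*n i j) ⟩
    + (2 ℕ.^ (column j ℕ.* d ℕ.+ i ℕ.+ (j ℕ.* w) ℕ./ m ℕ.* n))
                                            ≈⟨ 2^[a+k*n]≈2^a (column j ℕ.* d ℕ.+ i) ((j ℕ.* w) ℕ./ m) ⟩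
    + (2 ℕ.^ (column j ℕ.* d ℕ.+ i))        ∎)

  m≡[1+h]+[1+h] : m ≡ suc h ℕ.+ suc h
  m≡[1+h]+[1+h] = lemma h
    where
    lemma : ∀ h → 2 ℕ.+ h ℕ.* 2 ≡ suc h ℕ.+ suc h
    lemma = ℕ.solve-∀

  t*horner-alt1≈alt0 : t * horner t (alt 1 m) ≈ horner t (alt 0 m)
  t*horner-alt1≈alt0 = ≡⇒≈ (subst (λ k → t * horner t (alt 1 k) ≡ horner t (alt 0 k)) (sym m≡[1+h]+[1+h])
                                (t*horner-alt1 t (suc h)))

  t*horner-alt0≈alt1 : t * horner t (alt 0 m) ≈ horner t (alt 1 m)
  t*horner-alt0≈alt1 = subst (λ k → t * horner t (alt 0 k) ≈ horner t (alt 1 k)) (sym m≡[1+h]+[1+h]) (begin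
    t * h₀                            ≡⟨ lemma₁ (t * h₀) ⟩
    (t * h₀ + + 1) - + 1              ≡⟨ cong (_- + 1) (t*horner-alt0 t (suc h)) ⟩
    (h₁ + t ^ (suc h ℕ.+ suc h)) - + 1 ≈⟨ +-congʳ (- + 1) (+-congˡ h₁ (subst (λ k → t ^ k ≈ + 1) m≡[1+h]+[1+h] t^m≈1)) ⟩
    (h₁ + + 1) - + 1                  ≡⟨ lemma₂ h₁ ⟩
    h₁                                ∎)
    where
    h₀ : ℤ
    h₀ = horner t (alt 0 (suc h ℕ.+ suc h))
    h₁ : ℤ
    h₁ = horner t (alt 1 (suc h ℕ.+ suc h))
    lemma₁ : ∀ a → a ≡ (a + + 1) - + 1
    lemma₁ = solve-∀
    lemma₂ : ∀ a → (a + + 1) - + 1 ≡ a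
    lemma₂ = solve-∀

  module Rows (v c : ℕ) (w*v≡1+m*c : w ℕ.* v ≡ 1 ℕ.+ m ℕ.* c) where

    open Exponents.Inverse h q r′ v c w*v≡1+m*c using (v-odd; d*w*v≡d+c*n)

    2^d*U≈V : ∀ {U V} → t * U ≈ V → t * V ≈ U → + (2 ℕ.^ d) * U ≈ V
    2^d*U≈V {U} {V} tU≈V tV≈U = begin
      + (2 ℕ.^ d) * U          ≈⟨ *-congʳ U 2^d≈t^v ⟩
      t ^ v * U                ≡⟨ cong (λ k → t ^ k * U) (proj₂ v-odd) ⟩
      t ^ (1 ℕ.+ e ℕ.* 2) * U  ≈⟨ odd-power e ⟩
      V                        ∎
      where
      e : ℕ
      e = proj₁ v-odd
      2^d≈t^v : + (2 ℕ.^ d) ≈ t ^ v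
      2^d≈t^v = ≈-sym (begin
        t ^ v                       ≡⟨ pos-^ T v ⟨
        + (T ℕ.^ v)                 ≡⟨ cong +_ (ℕ.^-*-assoc 2 (d ℕ.* w) v) ⟩
        + (2 ℕ.^ (d ℕ.* w ℕ.* v))   ≡⟨ cong (λ k → + (2 ℕ.^ k)) d*w*v≡d+c*n ⟩
        + (2 ℕ.^ (d ℕ.+ c ℕ.* n))   ≈⟨ 2^[a+k*n]≈2^a d c ⟩
        + (2 ℕ.^ d)                 ∎)
      odd-power : ∀ e → t ^ (1 ℕ.+ e ℕ.* 2) * U ≈ V
      odd-power zero    = ≈-trans (≡⇒≈ (cong (_* U) (ℤ.*-identityʳ t))) tU≈V
      odd-power (suc e) = begin
        t * (t * t ^ (1 ℕ.+ e ℕ.* 2)) * U   ≡⟨ lemma t (t ^ (1 ℕ.+ e ℕ.* 2)) U ⟩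
        t * (t * (t ^ (1 ℕ.+ e ℕ.* 2) * U)) ≈⟨ *-congˡ t (*-congˡ t (odd-power e)) ⟩
        t * (t * V)                         ≈⟨ *-congˡ t tV≈U ⟩
        t * U                               ≈⟨ tU≈V ⟩
        V                                   ∎
        where
        lemma : ∀ t p u → t * (t * p) * u ≡ t * (t * (p * u))
        lemma = solve-∀

    module Matrix (a₁ x y : List ℕ) (a₁≤m : length a₁ ℕ.≤ m) (x≤m : length x ℕ.≤ m) (y≤m : length y ℕ.≤ m)
                  (tx≈y : t * horner t x ≈ horner t y) (ty≈x : t * horner t y ≈ horner t x)
                  (Φ₆a₁≈t²+y : Φ₆ t * horner t a₁ ≈ t * t + horner t y) where

      a : ℕ → ℕ → ℕ
      a i j = nth (rowOf a₁ x y i) j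

      value : List ℕ → ℕ
      value L = Σ< m (λ j → nth L j ℕ.* T ℕ.^ j)

      R : ℕ → ℕ
      R i = value (rowOf a₁ x y i)

      U V : ℕ
      U = value x
      V = value y

      +U≡horner : + U ≡ horner t x
      +U≡horner = Σ<-nth-pow≡horner T x m x≤m

      +V≡horner : + V ≡ horner t y
      +V≡horner = Σ<-nth-pow≡horner T y m y≤m

      tU≈V : t * + U ≈ + V
      tU≈V = subst₂ (λ u v → t * u ≈ v) (sym +U≡horner) (sym +V≡horner) tx≈y

      tV≈U : t * + V ≈ + U
      tV≈U = subst₂ (λ v u → t * v ≈ u) (sym +V≡horner) (sym +U≡horner) ty≈x

      S≈ΣR : + S n r d m a ≈ + Σ< d (λ i → 2 ℕ.^ i ℕ.* R i)
      S≈ΣR = ≈-trans (Σ<-cong-≈ d (λ i i<d → Σ<-cong-≈ m (λ j _ → entry i j i<d)))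
                     (≡⇒≈ (cong +_ (Σ<-cong-≗ d (λ i → trans (Σ<-cong-≗ m (λ j → x∙yz≈y∙xz (a i j) (2 ℕ.^ i) (T ℕ.^ j)))
                                                             (Σ<-*ˡ m (2 ℕ.^ i) _)))))
        where
        entry : ∀ i j → i ℕ.< d → + (a i j ℕ.* pow2 n (+ i - + (j ℕ.* r))) ≈ + (a i j ℕ.* (2 ℕ.^ i ℕ.* T ℕ.^ j))
        entry i j i<d = begin
          + (a i j ℕ.* pow2 n (+ i - + (j ℕ.* r)))     ≡⟨ cong (λ z → + (a i j ℕ.* z)) (pow2-exponent i j i<d) ⟩
          + (a i j ℕ.* 2 ℕ.^ (column j ℕ.* d ℕ.+ i))   ≡⟨ ℤ.pos-* (a i j) _ ⟩
          + a i j * + (2 ℕ.^ (column j ℕ.* d ℕ.+ i))   ≈⟨ *-congˡ (+ a i j) (2^[column*d+i]≈2^i*T^j i j) ⟩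
          + a i j * + (2 ℕ.^ i ℕ.* T ℕ.^ j)            ≡⟨ ℤ.pos-* (a i j) _ ⟨
          + (a i j ℕ.* (2 ℕ.^ i ℕ.* T ℕ.^ j))          ∎

      Φ₆S≈t² : Φ₆ t * + S n r d m a ≈ t * t
      Φ₆S≈t² = begin
        Φ₆ t * + S n r d m a                           ≈⟨ *-congˡ (Φ₆ t) S≈ΣR ⟩
        Φ₆ t * + Σ< d (λ i → 2 ℕ.^ i ℕ.* R i)          ≈⟨ Φ₆-rowSum t R R-odd R-even (Φ₆-pair t tU≈V tV≈U) (Φ₆-pair t tV≈U tU≈V) q ⟩
        Φ₆ t * + R 0 + + (2 ℕ.^ d) * + U - + 2 * + V   ≈⟨ +-congʳ (- (+ 2 * + V)) (+-cong Φ₆R₀≈t²+V (2^d*U≈V tU≈V tV≈U)) ⟩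
        (t * t + + V) + + V - + 2 * + V                ≡⟨ lemma (t * t) (+ V) ⟩
        t * t                                          ∎
        where
        R-odd : ∀ q → R (suc (q ℕ.* 2)) ≡ U
        R-odd q = cong value (rowOf-odd a₁ x y q)
        R-even : ∀ q → R (suc (suc (q ℕ.* 2))) ≡ V
        R-even q = cong value (rowOf-even a₁ x y q)
        Φ₆R₀≈t²+V : Φ₆ t * + R 0 ≈ t * t + + V
        Φ₆R₀≈t²+V = subst₂ (λ a₀ v → Φ₆ t * a₀ ≈ t * t + v) (sym (Σ<-nth-pow≡horner T a₁ m a₁≤m)) (sym +V≡horner) Φ₆a₁≈t²+y
        lemma : ∀ s v → (s + v) + v - + 2 * v ≡ s
        lemma = solve-∀

      K*S≈1 : + (K r ℕ.* S n r d m a) ≈ + 1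
      K*S≈1 = begin
        + (K r ℕ.* S n r d m a)           ≡⟨ ℤ.pos-* (K r) (S n r d m a) ⟩
        + K r * + S n r d m a             ≡⟨ cong (_* + S n r d m a) (K≡Φ₆ r) ⟩
        Φ₆ (+ (2 ℕ.^ r)) * + S n r d m a  ≈⟨ Φ₆-inverse {+ (2 ℕ.^ r)} {t} 2^r*t≈1 Φ₆S≈t² ⟩
        + 1                               ∎

module Solution (h q r′ : ℕ) where

  open import Data.Integer using (ℤ; +_; _+_; _*_; -_; _-_; _^_)
  open import Data.Integer.Tactic.RingSolver using (solve-∀)
  import Data.Nat as ℕ
  import Data.Nat.Properties as ℕ
  import Data.Nat.Tactic.RingSolver as ℕ
  import Data.Nat.DivMod as ℕ
  open import Data.List using (_∷_; length)
  open import Data.Nat.ListAction using (sum)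
  open import Data.List.Relation.Unary.All using (All; []; _∷_)
  open Exponents h q r′
  open Residues h q r′ using (t; t^m≈1; m≡[1+h]+[1+h]; t*horner-alt1≈alt0; t*horner-alt0≈alt1; module Rows)
  open Mersenne n
  open ≈-Reasoning

  weight : ℕ
  weight = (2 ℕ.+ h) ℕ.+ (1 ℕ.+ q ℕ.* 2) ℕ.* (1 ℕ.+ h)

  n+2≡weight*2 : n ℕ.+ 2 ≡ weight ℕ.* 2
  n+2≡weight*2 = lemma h q
    where
    lemma : ∀ h q → (2 ℕ.+ h ℕ.* 2) ℕ.* (2 ℕ.+ q ℕ.* 2) ℕ.+ 2 ≡ ((2 ℕ.+ h) ℕ.+ (1 ℕ.+ q ℕ.* 2) ℕ.* (1 ℕ.+ h)) ℕ.* 2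
    lemma = ℕ.solve-∀

  [n+2]/2≡weight : (n ℕ.+ 2) ℕ./ 2 ≡ weight
  [n+2]/2≡weight = trans (cong (ℕ._/ 2) n+2≡weight*2) (ℕ.m*n/n≡m weight 2)

  weight≢n : weight ≢ n
  weight≢n weight≡n = n≢2 (sym (ℕ.+-cancelˡ-≡ n 2 n (trans n+2≡weight*2 (trans (cong (ℕ._* 2) weight≡n) (lemma₁ n)))))
    where
    lemma₁ : ∀ n → n ℕ.* 2 ≡ n ℕ.+ n
    lemma₁ = ℕ.solve-∀
    lemma₂ : ∀ h q → (2 ℕ.+ h ℕ.* 2) ℕ.* (2 ℕ.+ q ℕ.* 2) ≡ 4 ℕ.+ (h ℕ.* 4 ℕ.+ q ℕ.* 4 ℕ.+ h ℕ.* q ℕ.* 4)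
    lemma₂ = ℕ.solve-∀
    n≢2 : n ≢ 2
    n≢2 n≡2 with trans (sym (lemma₂ h q)) n≡2
    ... | ()

  module _ (v c : ℕ) (w*v≡1+m*c : w ℕ.* v ≡ 1 ℕ.+ m ℕ.* c) where

    open Exponents.Inverse h q r′ v c w*v≡1+m*c using (wt-S; S<2^n)
    open Rows v c w*v≡1+m*c using (module Matrix)

    solution : ∀ a₁ x y → All (_≤ 1) a₁ → All (_≤ 1) x → All (_≤ 1) y
               → length a₁ ≡ m → length x ≡ m → length y ≡ m
               → sum a₁ ≡ 2 ℕ.+ h → sum x ≡ 1 ℕ.+ h → sum y ≡ 1 ℕ.+ h
               → t * horner t x ≈ horner t y → t * horner t y ≈ horner t x
               → Φ₆ t * horner t a₁ ≈ t * t + horner t y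
               → let s = S n r d m (λ i j → nth (rowOf a₁ x y i) j) in
                 IsLeastPosInverse M (K r) (s mod M) × wt (s mod M) ≡ (n ℕ.+ 2) ℕ./ 2
    solution a₁ x y a₁-bits x-bits y-bits |a₁| |x| |y| Σa₁ Σx Σy tx≈y ty≈x Φ₆a₁≈t²+y =
      proj₂ reduced , trans (cong wt (proj₁ reduced)) (trans wt[s]≡weight (sym [n+2]/2≡weight))
      where
      a : ℕ → ℕ → ℕ
      a i j = nth (rowOf a₁ x y i) j
      |a₁|≤m : length a₁ ≤ m
      |a₁|≤m = ℕ.≤-reflexive |a₁|
      |x|≤m : length x ≤ m
      |x|≤m = ℕ.≤-reflexive |x|
      |y|≤m : length y ≤ m
      |y|≤m = ℕ.≤-reflexive |y|
      bits : ∀ i j → a i j ≤ 1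
      bits i j = nth-All z≤n (rowOf-All (All (_≤ 1)) a₁-bits x-bits y-bits i) j
      wt[s]≡weight : wt (S n r d m a) ≡ weight
      wt[s]≡weight = trans (wt-S a bits) (trans (Σ<-rowOf (1 ℕ.+ q ℕ.* 2) |a₁|≤m |x|≤m |y|≤m Σx Σy)
                                                (cong (ℕ._+ (1 ℕ.+ q ℕ.* 2) ℕ.* (1 ℕ.+ h)) Σa₁))
      reduced : S n r d m a mod M ≡ S n r d m a × IsLeastPosInverse M (K r) (S n r d m a mod M)
      reduced = binary-isLeastPosInverse {K r} (S<2^n a bits) (λ wt≡0 → ℕ.0≢1+n (trans (sym wt≡0) wt[s]≡weight))
                                        (λ wt≡n → weight≢n (trans (sym wt[s]≡weight) wt≡n))
                                        (Matrix.K*S≈1 a₁ x y |a₁|≤m |x|≤m |y|≤m tx≈y ty≈x Φ₆a₁≈t²+y)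

    sum-alt-m : ∀ {b} → b ℕ.≤ 1 → sum (alt b m) ≡ 1 ℕ.+ h
    sum-alt-m {b} b≤1 = subst (λ e → sum (alt b e) ≡ suc h) (sym m≡[1+h]+[1+h]) (sum-alt (suc h) b≤1)

    case-a : ∀ k → h ≡ k ℕ.* 3 → let s = S n r d m (matA k m) in
             IsLeastPosInverse M (K r) (s mod M) × wt (s mod M) ≡ (n ℕ.+ 2) ℕ./ 2
    case-a k h≡k*3 = solution (1 ∷ 1 ∷ x₁ ^^ k) (alt 1 m) (alt 0 m)
      (1≤1 ∷ 1≤1 ∷ All-^^ k (1≤1 ∷ 1≤1 ∷ z≤n ∷ z≤n ∷ z≤n ∷ 1≤1 ∷ [])) (All-alt m 1≤1) (All-alt m z≤n)
      (trans (cong (2 ℕ.+_) (length-^^ x₁ k)) (sym m≡2+k*6)) (length-alt 1 m) (length-alt 0 m)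
      (cong (2 ℕ.+_) (trans (sum-^^ x₁ k) (sym h≡k*3))) (sum-alt-m 1≤1) (sum-alt-m z≤n)
      t*horner-alt1≈alt0 t*horner-alt0≈alt1 Φ₆a₁≈t²+y
      where
      1≤1 : 1 ≤ 1
      1≤1 = s≤s z≤n
      m≡2+k*6 : m ≡ 2 ℕ.+ k ℕ.* 6
      m≡2+k*6 = trans (cong (λ z → 2 ℕ.+ z ℕ.* 2) h≡k*3) (cong (2 ℕ.+_) (ℕ.*-assoc k 3 2))
      Φ₆a₁≈t²+y : Φ₆ t * horner t (1 ∷ 1 ∷ x₁ ^^ k) ≈ t * t + horner t (alt 0 m)
      Φ₆a₁≈t²+y = subst (λ e → Φ₆ t * horner t (1 ∷ 1 ∷ x₁ ^^ k) ≈ t * t + horner t (alt 0 e))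
                        (sym m≡2+k*6) (begin
        Φ₆ t * horner t (1 ∷ 1 ∷ x₁ ^^ k)
          ≡⟨ Φ₆*horner-a₁ᴬ t k ⟩
        t * t + y + (+ 1 - t) * (+ 1 - t ^ (2 ℕ.+ k ℕ.* 6))
          ≈⟨ +-congˡ (t * t + y) (*-congˡ (+ 1 - t) (+-congˡ (+ 1) (-‿cong t^[2+k*6]≈1))) ⟩
        t * t + y + (+ 1 - t) * (+ 1 - + 1)
          ≡⟨ lemma (t * t + y) t ⟩
        t * t + y ∎)
        where
        y : ℤ
        y = horner t (alt 0 (2 ℕ.+ k ℕ.* 6))
        t^[2+k*6]≈1 : t ^ (2 ℕ.+ k ℕ.* 6) ≈ + 1
        t^[2+k*6]≈1 = subst (λ e → t ^ e ≈ + 1) m≡2+k*6 t^m≈1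
        lemma : ∀ a t → a + (+ 1 - t) * (+ 1 - + 1) ≡ a
        lemma = solve-∀

    case-b : ∀ k → h ≡ 1 ℕ.+ k ℕ.* 3 → let s = S n r d m (matB k m) in
             IsLeastPosInverse M (K r) (s mod M) × wt (s mod M) ≡ (n ℕ.+ 2) ℕ./ 2
    case-b k h≡1+k*3 = solution (1 ∷ 0 ∷ 1 ∷ 1 ∷ x₂ ^^ k) (alt 0 m) (alt 1 m)
      (1≤1 ∷ z≤n ∷ 1≤1 ∷ 1≤1 ∷ All-^^ k (1≤1 ∷ z≤n ∷ z≤n ∷ z≤n ∷ 1≤1 ∷ 1≤1 ∷ [])) (All-alt m z≤n) (All-alt m 1≤1)
      (trans (cong (4 ℕ.+_) (length-^^ x₂ k)) (sym m≡4+k*6)) (length-alt 0 m) (length-alt 1 m)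
      (cong (2 ℕ.+_) (trans (cong suc (sum-^^ x₂ k)) (sym h≡1+k*3))) (sum-alt-m z≤n) (sum-alt-m 1≤1)
      t*horner-alt0≈alt1 t*horner-alt1≈alt0 Φ₆a₁≈t²+y
      where
      1≤1 : 1 ≤ 1
      1≤1 = s≤s z≤n
      m≡4+k*6 : m ≡ 4 ℕ.+ k ℕ.* 6
      m≡4+k*6 = trans (cong (λ z → 2 ℕ.+ z ℕ.* 2) h≡1+k*3) (cong (4 ℕ.+_) (ℕ.*-assoc k 3 2))
      Φ₆a₁≈t²+y : Φ₆ t * horner t (1 ∷ 0 ∷ 1 ∷ 1 ∷ x₂ ^^ k) ≈ t * t + horner t (alt 1 m)
      Φ₆a₁≈t²+y = subst (λ e → Φ₆ t * horner t (1 ∷ 0 ∷ 1 ∷ 1 ∷ x₂ ^^ k) ≈ t * t + horner t (alt 1 e))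
                        (sym m≡4+k*6) (begin
        Φ₆ t * horner t (1 ∷ 0 ∷ 1 ∷ 1 ∷ x₂ ^^ k)
          ≡⟨ Φ₆*horner-a₁ᴮ t k ⟩
        t * t + y + t * (t ^ (4 ℕ.+ k ℕ.* 6) - + 1)
          ≈⟨ +-congˡ (t * t + y) (*-congˡ t (+-congʳ (- + 1) t^[4+k*6]≈1)) ⟩
        t * t + y + t * (+ 1 - + 1)
          ≡⟨ lemma (t * t + y) t ⟩
        t * t + y ∎)
        where
        y : ℤ
        y = horner t (alt 1 (4 ℕ.+ k ℕ.* 6))
        t^[4+k*6]≈1 : t ^ (4 ℕ.+ k ℕ.* 6) ≈ + 1
        t^[4+k*6]≈1 = subst (λ e → t ^ e ≈ + 1) m≡4+k*6 t^m≈1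
        lemma : ∀ a t → a + t * (+ 1 - + 1) ≡ a
        lemma = solve-∀

open import Data.Nat using (_+_; _*_; _∸_; _^_; _/_)
open import Data.Nat.Properties using (*-cancelʳ-≡; +-cancelˡ-≡; *-zeroʳ; <-irrefl)
open import Data.Nat.GCD using (gcd; gcd-GCD; gcd[m,n]∣m; gcd-greatest; module Bézout)
open import Data.Nat.Divisibility using (_∣_; divides; ∣m⇒∣m*n)
open import Data.Nat.Coprimality using (Bézout-coprime)
open import Data.Nat.Tactic.RingSolver using (solve-∀)
open import Relation.Nullary using (¬_)

Conclusion : ℕ → ℕ → ℕ → ℕ → Set
Conclusion n r d m =
  (∀ k → m ≡ 6 * k + 2
     → IsLeastPosInverse (2 ^ n ∸ 1) (K r) (S n r d m (matA k m) mod (2 ^ n ∸ 1))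
       × wt (S n r d m (matA k m) mod (2 ^ n ∸ 1)) ≡ (n + 2) / 2)
  × (∀ k → m ≡ 6 * k + 4
     → IsLeastPosInverse (2 ^ n ∸ 1) (K r) (S n r d m (matB k m) mod (2 ^ n ∸ 1))
       × wt (S n r d m (matB k m) mod (2 ^ n ∸ 1)) ≡ (n + 2) / 2)

conclusion : ∀ h q r′ → let open Exponents h q r′ in gcd r n ≡ d → Conclusion n r d m
conclusion h q r′ gcd≡d = from-inverse (inverse-of-negation {r′} {h * 2} (Bézout-coprime identity))
  where
  open Exponents h q r′
  open Solution h q r′
  identity : Bézout.Identity d r n
  identity = subst (λ g → Bézout.Identity g r n) gcd≡d (Bézout.identity (gcd-GCD r n))
  h≡ : ∀ k j → 2 + h * 2 ≡ 6 * k + 2 * suc j → h ≡ j + k * 3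
  h≡ k j eq = *-cancelʳ-≡ h (j + k * 3) 2 (+-cancelˡ-≡ 2 (h * 2) _ (trans eq (lemma k j)))
    where
    lemma : ∀ k j → 6 * k + 2 * suc j ≡ 2 + (j + k * 3) * 2
    lemma = solve-∀
  from-inverse : (∃ λ v → ∃ λ c → w * v ≡ 1 + m * c) → Conclusion n r d m
  from-inverse (v , c , w*v≡1+m*c) = (λ k m≡6k+2 → case-a v c w*v≡1+m*c k (h≡ k 0 m≡6k+2))
                                   , (λ k m≡6k+4 → case-b v c w*v≡1+m*c k (h≡ k 1 m≡6k+4))

proposition8 : (n r d m : ℕ) → 0 < n → 0 < r → d ≡ gcd r n → n ≡ m * d
    → 2 ∣ r → 2 ∣ m → ¬ (3 ∣ m)
    → (∀ k → m ≡ 6 * k + 2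
    → IsLeastPosInverse (2 ^ n ∸ 1) (K r) (S n r d m (matA k m) mod (2 ^ n ∸ 1))
    × wt (S n r d m (matA k m) mod (2 ^ n ∸ 1)) ≡ (n + 2) / 2)
    × (∀ k → m ≡ 6 * k + 4
    → IsLeastPosInverse (2 ^ n ∸ 1) (K r) (S n r d m (matB k m) mod (2 ^ n ∸ 1))
    × wt (S n r d m (matB k m) mod (2 ^ n ∸ 1)) ≡ (n + 2) / 2)
proposition8 n r d m 0<n 0<r d≡gcd n≡m*d 2∣r 2∣m _ =
  parametrise n≡m*d d∣r 2∣d 2∣m d≡gcd 0<n 0<r
  where
  d∣r : d ∣ r
  d∣r = subst (_∣ r) (sym d≡gcd) (gcd[m,n]∣m r n)
  2∣d : 2 ∣ d
  2∣d = subst (2 ∣_) (sym d≡gcd) (gcd-greatest 2∣r (subst (2 ∣_) (sym n≡m*d) (∣m⇒∣m*n d 2∣m)))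
  parametrise : ∀ {n r d m} → n ≡ m * d → d ∣ r → 2 ∣ d → 2 ∣ m → d ≡ gcd r n → 0 < n → 0 < r → Conclusion n r d m
  parametrise refl (divides r′ refl) (divides (suc q) refl) (divides (suc h) refl) d≡gcd _ _ = conclusion h q r′ (sym d≡gcd)
  parametrise refl (divides r′ refl) (divides zero refl) _ _ _ 0<r =
    contradiction (subst (0 <_) (*-zeroʳ r′) 0<r) (<-irrefl refl)
  parametrise refl (divides r′ refl) (divides (suc q) refl) (divides zero refl) _ () _
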